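{- Let $f=m_1+\dots+m_t$ be a $d$-intersecting, $k$-homogeneous $n$-variable Boolean function, with $m_1,\dots,m_t$ the distinct monomials of its ANF. Then \[\left|\bigcap_{i=1}^tN_k(m_i)\right|=2^{k(n-tk+(t-1)d)}\prod_{i=0}^{k-d-1}\left(2^k-2^{i+d}\right)^{t-1}.\]
   Context: An $n$-variable Boolean function is written in algebraic normal form (ANF) as a sum of distinct monomials $x_I=\prod_{i\in I}x_i$, $I\subseteq[n]$; $\mathrm{Var}(x_I)=I$. It is $k$-homogeneous if all its monomials have degree $k$. For $0\le d\le n-1$, $f=m_1+\dots+m_t$ is $d$-intersecting if there exists $D\subseteq[n]$ with $|D|=d$ such that $\mathrm{Var}(m_i)\cap\mathrm{Var}(m_j)=D$ for all $i\ne j$. For a Boolean function $g$, $N_k(g)$ is the set of $k$-dimensional linear subspaces $U$ of $\mathbb{F}_2^n$ with $\sum_{x\in U}g(x)\neq0$. -}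

module Defs where

open import Data.Nat using (ℕ; zero; suc; _+_; _*_; _∸_; _^_; _<_)
open import Data.Bool using (Bool; true; false; _xor_; _∧_; _∨_; not; if_then_else_)
open import Data.Product using (Σ; _×_; _,_; ∃)
open import Data.Vec using (Vec; []; _∷_; replicate; zipWith; foldr)
open import Data.List as List using (List; length; map; _++_; [_])
open import Data.List.Membership.Propositional using (_∈_)
open import Data.List.Relation.Unary.Unique.Propositional using (Unique)
open import Data.Fin using (Fin)
open import Data.Fin.Subset using (Subset; _∩_; ∣_∣)
open import Relation.Binary.PropositionalEquality using (_≡_; _≢_)
open import Function.Bundles using (_⇔_)

-- Vectors of 𝔽₂ⁿ : Vec Bool n (true = 1, xor = addition).
F2^ : ℕ → Set
F2^ n = Vec Bool n

_⊕_ : ∀ {n} → F2^ n → F2^ n → F2^ n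
_⊕_ = zipWith _xor_

𝟎 : ∀ {n} → F2^ n
𝟎 = replicate _ false

allVecs : (n : ℕ) → List (F2^ n)
allVecs zero = [ [] ]
allVecs (suc n) = map (false ∷_) (allVecs n) ++ map (true ∷_) (allVecs n)

-- A subset of 𝔽₂ⁿ, represented concretely by its truth table (a binary trie),
-- so that subsets have decidable propositional equality.
SubsetF2 : ℕ → Set
SubsetF2 zero = Bool
SubsetF2 (suc n) = SubsetF2 n × SubsetF2 n

_∈U_ : ∀ {n} → F2^ n → SubsetF2 n → Bool
_∈U_ {zero} [] b = b
_∈U_ {suc n} (false ∷ x) (l , r) = x ∈U l
_∈U_ {suc n} (true ∷ x) (l , r) = x ∈U r

lin : ∀ {n k} → Vec (F2^ n) k → Vec Bool k → F2^ n
lin [] [] = 𝟎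
lin (b ∷ B) (c ∷ cs) = if c then b ⊕ lin B cs else lin B cs

IsSubspaceDim : ∀ {n} → ℕ → SubsetF2 n → Set
IsSubspaceDim {n} k U =
  Σ (Vec (F2^ n) k) λ B →
    (∀ c → lin B c ≡ 𝟎 → c ≡ replicate k false) ×
    (∀ x → (x ∈U U ≡ true) ⇔ (∃ λ c → lin B c ≡ x))

sumOver : ∀ {n} → SubsetF2 n → (F2^ n → Bool) → Bool
sumOver {n} U g = List.foldr (λ x acc → (x ∈U U ∧ g x) xor acc) false (allVecs n)

InN : ∀ {n} → ℕ → (F2^ n → Bool) → SubsetF2 n → Set
InN k g U = IsSubspaceDim k U × sumOver U g ≡ true

monomial : ∀ {n} → Subset n → F2^ n → Bool
monomial I x = foldr _ _∧_ true (zipWith (λ i xi → not i ∨ xi) I x)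

HasSize : ∀ {n} → (SubsetF2 n → Set) → ℕ → Set
HasSize {n} P N =
  Σ (List (SubsetF2 n)) λ L →
    Unique L × (∀ U → (U ∈ L) ⇔ P U) × length L ≡ N

-- f = m_1 + ... + m_t given by its (distinct) ANF monomials, m i = Var(m_i).
-- k-homogeneous
Homogeneous : ∀ {n t} → ℕ → (Fin t → Subset n) → Set
Homogeneous k m = ∀ i → ∣ m i ∣ ≡ k

Intersecting : ∀ {n t} → ℕ → (Fin t → Subset n) → Set
Intersecting {n} d m =
  d < n × Σ (Subset n) λ D → ∣ D ∣ ≡ d × (∀ i j → i ≢ j → m i ∩ m j ≡ D)

prod< : ℕ → (ℕ → ℕ) → ℕ
prod< zero f = 1
prod< (suc r) f = prod< r f * f r

-- For a k-dimensional U ≤ 𝔽₂ⁿ and |J| = k, the sum of x_J over U is 1 iff the coordinate projection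
-- π_J is injective on U; otherwise the summand is invariant under a nonzero translation of U and the
-- sum vanishes. So U ∈ N_k(x_I) exactly when U is the column space of a (unique) n × k matrix C whose
-- rows at I form the identity, and then U ∈ N_k(x_J) iff the k rows of C at J are independent.
-- For I = m₀ and J = m_i these are the d identity rows at D = m_i ∩ m₀ together with the rows at the
-- petal m_i ─ m₀, and distinct petals are disjoint. Choosing the rows of C one at a time, the j-th row
-- of a petal must avoid the span of the d + j rows of its family chosen before (2^k − 2^(d+j) choices),
-- and each of the n − k − t(k − d) rows outside m₀ and the petals is arbitrary (2^k choices).

module Submission where

open import Defs
open import Data.Nat using (ℕ; zero; suc; _+_; _*_; _∸_; _^_; _≤_; _<_)
open import Data.Nat.Properties
  using ( ≤-refl; ≤-trans; ≤-reflexive; <-irrefl; ^-monoʳ-≤; m+n∸m≡n; m+n∸n≡m; +-suc; +-identityʳ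
        ; +-assoc; *-assoc; *-identityˡ; *-identityʳ; *-zeroʳ; ^-distribˡ-+-*; *-suc
        ; ^-zeroˡ; +-commutativeSemigroup; *-commutativeSemigroup)
open import Data.Bool using (Bool; true; false; _xor_; _∧_; not; if_then_else_)
open import Data.Bool.Properties
  using ( xor-assoc; xor-comm; xor-same; xor-identityˡ; xor-identityʳ; ∧-comm; ∧-distribʳ-xor
        ; ¬-not; ⇔→≡; xor-∧-commutativeRing)
  renaming (_≟_ to _≟ᴮ_)
open import Data.Empty using (⊥)
open import Data.Sum using (inj₁; inj₂)
open import Data.Product using (Σ; _×_; _,_; ∃; proj₁; proj₂)
open import Data.Unit using (⊤; tt)
open import Data.Vec using (Vec; []; _∷_; head; tail; lookup; tabulate; replicate; map; toList; fromList)
import Data.Vec.Properties as Vecₚ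
open import Data.List as List using (List; []; _∷_; length; _++_; filter)
import Data.List.Properties as Listₚ
open import Data.List.Membership.Propositional using (_∈_)
import Data.List.Membership.Propositional.Properties as ∈ₚ
open import Data.List.Membership.Propositional.Properties.WithK using (unique∧set⇒bag)
open import Data.List.Relation.Unary.All as All using (All; []; _∷_)
import Data.List.Relation.Unary.All.Properties as Allₚ
open import Data.List.Relation.Unary.Any as Any using (here; there)
open import Data.List.Relation.Unary.Unique.Propositional using (Unique)
open import Data.List.Relation.Unary.AllPairs using ([]; _∷_)
import Data.List.Relation.Unary.Unique.Propositional.Properties as Uniqueₚ
open import Data.List.Relation.Binary.BagAndSetEquality using (∼bag⇒↭)
open import Data.List.Relation.Binary.Permutation.Propositional using (_↭_; ↭-sym; ↭-trans; ↭-refl; ↭-prep)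
open import Data.List.Relation.Binary.Permutation.Propositional.Properties
  using (↭-length; All-resp-↭; shift)
open import Algebra.Bundles using (CommutativeRing)
open import Algebra.Properties.CommutativeSemigroup
  (CommutativeRing.+-commutativeSemigroup xor-∧-commutativeRing) using () renaming (interchange to xor-interchange)
open import Algebra.Properties.CommutativeSemigroup +-commutativeSemigroup
  using () renaming (interchange to +-interchange)
open import Algebra.Properties.CommutativeSemigroup *-commutativeSemigroup
  using () renaming (interchange to *-interchange; x∙yz≈y∙xz to *-leftComm)
open import Data.Fin using (Fin; zero; suc)
import Data.Fin.Properties as Finₚ
open import Data.Maybe using (Maybe; just; nothing)
open import Data.Vec.Functional using (updateAt)
open import Data.Vec.Functional.Properties using (updateAt-updates; updateAt-minimal)
open import Data.Fin.Subset using (Subset; ∣_∣; _∩_; _─_)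
open import Function using (_∘_)
open import Function.Bundles using (_⇔_; mk⇔; Equivalence)
import Function.Properties.Equivalence as ⇔
open import Function.Definitions using (Injective)
open import Relation.Binary using (DecidableEquality)
open import Relation.Binary.PropositionalEquality
  using (_≡_; _≢_; refl; sym; trans; cong; cong₂; subst; subst₂; module ≡-Reasoning)
open import Relation.Nullary using (Dec; yes; no; ¬_; does; contradiction)
open import Relation.Nullary.Decidable using (¬?)

open Equivalence using (to; from)

_≟ᵛ_ : ∀ {n} → DecidableEquality (F2^ n)
_≟ᵛ_ = Vecₚ.≡-dec _≟ᴮ_


⊕-assoc : ∀ {n} (x y z : F2^ n) → (x ⊕ y) ⊕ z ≡ x ⊕ (y ⊕ z)
⊕-assoc = Vecₚ.zipWith-assoc xor-assoc

⊕-comm : ∀ {n} (x y : F2^ n) → x ⊕ y ≡ y ⊕ x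
⊕-comm = Vecₚ.zipWith-comm xor-comm

⊕-identityˡ : ∀ {n} (x : F2^ n) → 𝟎 ⊕ x ≡ x
⊕-identityˡ = Vecₚ.zipWith-identityˡ xor-identityˡ

⊕-identityʳ : ∀ {n} (x : F2^ n) → x ⊕ 𝟎 ≡ x
⊕-identityʳ = Vecₚ.zipWith-identityʳ xor-identityʳ

⊕-self : ∀ {n} (x : F2^ n) → x ⊕ x ≡ 𝟎
⊕-self []      = refl
⊕-self (a ∷ x) = cong₂ _∷_ (xor-same a) (⊕-self x)

⊕-cancelʳ : ∀ {n} (x y : F2^ n) → (x ⊕ y) ⊕ y ≡ x
⊕-cancelʳ x y = begin
  (x ⊕ y) ⊕ y ≡⟨ ⊕-assoc x y y ⟩
  x ⊕ (y ⊕ y) ≡⟨ cong (x ⊕_) (⊕-self y) ⟩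
  x ⊕ 𝟎       ≡⟨ ⊕-identityʳ x ⟩
  x           ∎
  where open ≡-Reasoning

⊕≡𝟎⇒≡ : ∀ {n} {x y : F2^ n} → x ⊕ y ≡ 𝟎 → x ≡ y
⊕≡𝟎⇒≡ {x = x} {y} x⊕y≡𝟎 = begin
  x           ≡⟨ sym (⊕-cancelʳ x y) ⟩
  (x ⊕ y) ⊕ y ≡⟨ cong (_⊕ y) x⊕y≡𝟎 ⟩
  𝟎 ⊕ y       ≡⟨ ⊕-identityˡ y ⟩
  y           ∎
  where open ≡-Reasoning

⊕-interchange : ∀ {n} (a b c d : F2^ n) → (a ⊕ b) ⊕ (c ⊕ d) ≡ (a ⊕ c) ⊕ (b ⊕ d)
⊕-interchange a b c d = begin
  (a ⊕ b) ⊕ (c ⊕ d) ≡⟨ ⊕-assoc a b (c ⊕ d) ⟩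
  a ⊕ (b ⊕ (c ⊕ d)) ≡⟨ cong (a ⊕_) (sym (⊕-assoc b c d)) ⟩
  a ⊕ ((b ⊕ c) ⊕ d) ≡⟨ cong (λ z → a ⊕ (z ⊕ d)) (⊕-comm b c) ⟩
  a ⊕ ((c ⊕ b) ⊕ d) ≡⟨ cong (a ⊕_) (⊕-assoc c b d) ⟩
  a ⊕ (c ⊕ (b ⊕ d)) ≡⟨ sym (⊕-assoc a c (b ⊕ d)) ⟩
  (a ⊕ c) ⊕ (b ⊕ d) ∎
  where open ≡-Reasoning

Additive : ∀ {m n} → (F2^ m → F2^ n) → Set
Additive f = ∀ x y → f (x ⊕ y) ≡ f x ⊕ f y

TrivialKernel : ∀ {m n} → (F2^ m → F2^ n) → Set
TrivialKernel f = ∀ x → f x ≡ 𝟎 → x ≡ 𝟎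

additive⇒𝟎↦𝟎 : ∀ {m n} {f : F2^ m → F2^ n} → Additive f → f 𝟎 ≡ 𝟎
additive⇒𝟎↦𝟎 {f = f} f-additive = begin
  f 𝟎         ≡⟨ cong f (sym (⊕-self 𝟎)) ⟩
  f (𝟎 ⊕ 𝟎)   ≡⟨ f-additive 𝟎 𝟎 ⟩
  f 𝟎 ⊕ f 𝟎   ≡⟨ ⊕-self (f 𝟎) ⟩
  𝟎           ∎
  where open ≡-Reasoning

trivialKernel⇒injective : ∀ {m n} {f : F2^ m → F2^ n} →
  Additive f → TrivialKernel f → Injective _≡_ _≡_ f
trivialKernel⇒injective {f = f} f-additive ker {x} {y} fx≡fy =
  ⊕≡𝟎⇒≡ (ker (x ⊕ y) (trans (f-additive x y) (trans (cong (_⊕ f y) fx≡fy) (⊕-self (f y)))))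

lin-⊕ : ∀ {n k} (B : Vec (F2^ n) k) → Additive (lin B)
lin-⊕ []      []          []           = sym (⊕-self 𝟎)
lin-⊕ (b ∷ B) (false ∷ c) (false ∷ c′) = lin-⊕ B c c′
lin-⊕ (b ∷ B) (true ∷ c)  (false ∷ c′) =
  trans (cong (b ⊕_) (lin-⊕ B c c′)) (sym (⊕-assoc b (lin B c) (lin B c′)))
lin-⊕ (b ∷ B) (false ∷ c) (true ∷ c′)  = begin
  b ⊕ lin B (c ⊕ c′)          ≡⟨ cong (b ⊕_) (lin-⊕ B c c′) ⟩
  b ⊕ (lin B c ⊕ lin B c′)    ≡⟨ sym (⊕-assoc b (lin B c) (lin B c′)) ⟩
  (b ⊕ lin B c) ⊕ lin B c′    ≡⟨ cong (_⊕ lin B c′) (⊕-comm b (lin B c)) ⟩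
  (lin B c ⊕ b) ⊕ lin B c′    ≡⟨ ⊕-assoc (lin B c) b (lin B c′) ⟩
  lin B c ⊕ (b ⊕ lin B c′)    ∎
  where open ≡-Reasoning
lin-⊕ (b ∷ B) (true ∷ c)  (true ∷ c′)  = begin
  lin B (c ⊕ c′)                    ≡⟨ lin-⊕ B c c′ ⟩
  lin B c ⊕ lin B c′                ≡⟨ sym (⊕-identityˡ _) ⟩
  𝟎 ⊕ (lin B c ⊕ lin B c′)          ≡⟨ cong (_⊕ (lin B c ⊕ lin B c′)) (sym (⊕-self b)) ⟩
  (b ⊕ b) ⊕ (lin B c ⊕ lin B c′)    ≡⟨ ⊕-interchange b b (lin B c) (lin B c′) ⟩
  (b ⊕ lin B c) ⊕ (b ⊕ lin B c′)    ∎
  where open ≡-Reasoning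

lin-map : ∀ {m n k} {f : F2^ m → F2^ n} → Additive f →
  (B : Vec (F2^ m) k) (c : Vec Bool k) → lin (map f B) c ≡ f (lin B c)
lin-map f-additive []      []          = sym (additive⇒𝟎↦𝟎 f-additive)
lin-map f-additive (b ∷ B) (false ∷ c) = lin-map f-additive B c
lin-map f-additive (b ∷ B) (true ∷ c)  =
  trans (cong (_ ⊕_) (lin-map f-additive B c)) (sym (f-additive b (lin B c)))

-- Enumeration and counting

∈-allVecs : ∀ {n} (x : F2^ n) → x ∈ allVecs n
∈-allVecs []          = here refl
∈-allVecs (false ∷ x) = ∈ₚ.∈-++⁺ˡ (∈ₚ.∈-map⁺ (false ∷_) (∈-allVecs x))
∈-allVecs {suc n} (true ∷ x) =
  ∈ₚ.∈-++⁺ʳ (List.map (false ∷_) (allVecs n)) (∈ₚ.∈-map⁺ (true ∷_) (∈-allVecs x))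

allVecs-unique : ∀ n → Unique (allVecs n)
allVecs-unique zero    = [] ∷ []
allVecs-unique (suc n) =
  Uniqueₚ.++⁺ (Uniqueₚ.map⁺ Vecₚ.∷-injectiveʳ (allVecs-unique n))
              (Uniqueₚ.map⁺ Vecₚ.∷-injectiveʳ (allVecs-unique n))
              heads-differ
  where
  heads-differ : ∀ {v} → v ∈ List.map (false ∷_) (allVecs n) × v ∈ List.map (true ∷_) (allVecs n) → ⊥
  heads-differ (v∈ˡ , v∈ʳ) with ∈ₚ.∈-map⁻ (false ∷_) v∈ˡ | ∈ₚ.∈-map⁻ (true ∷_) v∈ʳ
  ... | _ , _ , refl | _ , _ , ()

length-allVecs : ∀ n → length (allVecs n) ≡ 2 ^ n
length-allVecs zero    = refl
length-allVecs (suc n) = begin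
  length (List.map (false ∷_) (allVecs n) ++ List.map (true ∷_) (allVecs n))
    ≡⟨ Listₚ.length-++ (List.map (false ∷_) (allVecs n)) ⟩
  length (List.map (false ∷_) (allVecs n)) + length (List.map (true ∷_) (allVecs n))
    ≡⟨ cong₂ _+_ (half false) (trans (half true) (sym (+-identityʳ (2 ^ n)))) ⟩
  2 ^ n + (2 ^ n + 0) ∎
  where
  open ≡-Reasoning
  half : ∀ b → length (List.map (b ∷_) (allVecs n)) ≡ 2 ^ n
  half b = trans (Listₚ.length-map (b ∷_) (allVecs n)) (length-allVecs n)

HasCard : ∀ {A : Set} → (A → Set) → ℕ → Set
HasCard {A} P N = Σ (List A) λ L → Unique L × (∀ x → x ∈ L ⇔ P x) × length L ≡ N

unique-length : ∀ {A : Set} {xs ys : List A} → Unique xs → Unique ys →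
  (∀ x → x ∈ xs ⇔ x ∈ ys) → length xs ≡ length ys
unique-length xs-unique ys-unique xs⇔ys =
  ↭-length (∼bag⇒↭ (unique∧set⇒bag xs-unique ys-unique (λ {x} → xs⇔ys x)))

module _ {A : Set} where

  HasCard-unique : ∀ {P : A → Set} {N M} → HasCard P N → HasCard P M → N ≡ M
  HasCard-unique (L , L-unique , L⇔ , refl) (L′ , L′-unique , L′⇔ , refl) =
    unique-length L-unique L′-unique (λ x → ⇔.trans (L⇔ x) (⇔.sym (L′⇔ x)))

  HasCard-cong : ∀ {P Q : A → Set} {N} → (∀ x → P x ⇔ Q x) → HasCard P N → HasCard Q N
  HasCard-cong P⇔Q (L , L-unique , L⇔ , len) = L , L-unique , (λ x → ⇔.trans (L⇔ x) (P⇔Q x)) , len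

  HasCard-≡ : (a : A) → HasCard (_≡ a) 1
  HasCard-≡ a = a ∷ [] , [] ∷ [] , (λ x → mk⇔ (λ { (here x≡a) → x≡a ; (there ()) }) here) , refl

  length-filter+length-filter-∁ : ∀ {P : A → Set} (P? : ∀ x → Dec (P x)) xs →
    length (filter P? xs) + length (filter (¬? ∘ P?) xs) ≡ length xs
  length-filter+length-filter-∁ P? []       = refl
  length-filter+length-filter-∁ P? (x ∷ xs) with P? x
  ... | yes _ = cong suc (length-filter+length-filter-∁ P? xs)
  ... | no  _ = trans (+-suc _ _) (cong suc (length-filter+length-filter-∁ P? xs))

  HasCard-filter : ∀ {P : A → Set} (P? : ∀ x → Dec (P x)) {L} → Unique L → (∀ x → x ∈ L) →
    HasCard P (length (filter P? L))
  HasCard-filter P? {L} L-unique L-complete =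
    filter P? L , Uniqueₚ.filter⁺ P? L-unique ,
    (λ x → mk⇔ (proj₂ ∘ ∈ₚ.∈-filter⁻ P? {xs = L}) (∈ₚ.∈-filter⁺ P? (L-complete x))) , refl

  HasCard-∁ : ∀ {P : A → Set} {N M} → (∀ x → Dec (P x)) →
    HasCard {A} (λ _ → ⊤) N → HasCard P M → HasCard (¬_ ∘ P) (N ∸ M)
  HasCard-∁ {M = M} P? (L , L-unique , L⇔ , refl) P-card =
    subst (HasCard _) length≡ (HasCard-filter (¬? ∘ P?) L-unique L-complete)
    where
    open ≡-Reasoning
    L-complete : ∀ x → x ∈ L
    L-complete x = from (L⇔ x) tt
    length≡ : length (filter (¬? ∘ P?) L) ≡ length L ∸ M
    length≡ = begin
      length (filter (¬? ∘ P?) L)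
        ≡⟨ sym (m+n∸m≡n (length (filter P? L)) _) ⟩
      length (filter P? L) + length (filter (¬? ∘ P?) L) ∸ length (filter P? L)
        ≡⟨ cong₂ _∸_ (length-filter+length-filter-∁ P? L)
                     (HasCard-unique (HasCard-filter P? L-unique L-complete) P-card) ⟩
      length L ∸ M ∎

HasCard-image : ∀ {A B : Set} {P : A → Set} {Q : B → Set} {N} (f : A → B) →
  (∀ {x y} → P x → P y → f x ≡ f y → x ≡ y) →
  (∀ y → Q y ⇔ ∃ λ x → P x × f x ≡ y) → HasCard P N → HasCard Q N
HasCard-image {P = P} {Q} f f-injective Q⇔ (L , L-unique , L⇔ , len) =
  List.map f L ,
  map-unique (All.tabulate (λ {x} → to (L⇔ x))) L-unique ,
  (λ y → mk⇔ (image⇒Q y) (Q⇒image y)) ,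
  trans (Listₚ.length-map f L) len
  where
  map-unique : ∀ {xs} → All P xs → Unique xs → Unique (List.map f xs)
  map-unique []           []                  = []
  map-unique (px ∷ P-xs) (x∉xs ∷ xs-unique) =
    Allₚ.map⁺ (All.zipWith (λ (x≢y , py) fx≡fy → x≢y (f-injective px py fx≡fy)) (x∉xs , P-xs))
    ∷ map-unique P-xs xs-unique
  image⇒Q : ∀ y → y ∈ List.map f L → Q y
  image⇒Q y y∈ with ∈ₚ.∈-map⁻ f y∈
  ... | x , x∈L , refl = from (Q⇔ (f x)) (x , to (L⇔ x) x∈L , refl)
  Q⇒image : ∀ y → Q y → y ∈ List.map f L
  Q⇒image y qy with to (Q⇔ y) qy
  ... | x , px , refl = ∈ₚ.∈-map⁺ f (from (L⇔ x) px)

HasCard-F2^ : ∀ n → HasCard {F2^ n} (λ _ → ⊤) (2 ^ n)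
HasCard-F2^ n = allVecs n , allVecs-unique n , (λ x → mk⇔ (λ _ → tt) (λ _ → ∈-allVecs x)) , length-allVecs n

HasCard-[] : ∀ {A : Set} {R : Vec A 0 → Set} → R [] → HasCard R 1
HasCard-[] r = [] ∷ [] , [] ∷ [] , (λ { [] → mk⇔ (λ _ → r) (λ _ → here refl) }) , refl

module _ {A : Set} {n b : ℕ} {Q : A → Vec A n → Set} where

  private
    HasCard-∷-from : (cs : List A) → Unique cs → (∀ c → c ∈ cs → HasCard (Q c) b) →
      HasCard (λ v → head v ∈ cs × Q (head v) (tail v)) (length cs * b)
    HasCard-∷-from [] [] _ = [] , [] , (λ _ → mk⇔ (λ ()) (λ ())) , refl
    HasCard-∷-from (c ∷ cs) (c∉cs ∷ cs-unique) Q-card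
      with Q-card c (here refl) | HasCard-∷-from cs cs-unique (λ c′ → Q-card c′ ∘ there)
    ... | L₀ , L₀-unique , L₀⇔ , len₀ | L , L-unique , L⇔ , len =
      List.map (c ∷_) L₀ ++ L ,
      Uniqueₚ.++⁺ (Uniqueₚ.map⁺ Vecₚ.∷-injectiveʳ L₀-unique) L-unique disjoint ,
      (λ v → mk⇔ (⇒ v) (⇐ v)) ,
      trans (Listₚ.length-++ (List.map (c ∷_) L₀))
            (cong₂ _+_ (trans (Listₚ.length-map (c ∷_) L₀) len₀) len)
      where
      disjoint : ∀ {v} → v ∈ List.map (c ∷_) L₀ × v ∈ L → ⊥
      disjoint (v∈ˡ , v∈L) with ∈ₚ.∈-map⁻ (c ∷_) v∈ˡ
      ... | _ , _ , refl = All.lookup c∉cs (proj₁ (to (L⇔ _) v∈L)) refl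
      ⇒ : ∀ v → v ∈ List.map (c ∷_) L₀ ++ L → head v ∈ c ∷ cs × Q (head v) (tail v)
      ⇒ v v∈ with ∈ₚ.∈-++⁻ (List.map (c ∷_) L₀) v∈
      ... | inj₂ v∈L = let (h∈ , q) = to (L⇔ v) v∈L in there h∈ , q
      ... | inj₁ v∈ˡ with ∈ₚ.∈-map⁻ (c ∷_) v∈ˡ
      ...   | C , C∈L₀ , refl = here refl , to (L₀⇔ C) C∈L₀
      ⇐ : ∀ v → head v ∈ c ∷ cs × Q (head v) (tail v) → v ∈ List.map (c ∷_) L₀ ++ L
      ⇐ (.c ∷ C) (here refl , q) = ∈ₚ.∈-++⁺ˡ (∈ₚ.∈-map⁺ (c ∷_) (from (L₀⇔ C) q))
      ⇐ v        (there h∈ , q)  = ∈ₚ.∈-++⁺ʳ (List.map (c ∷_) L₀) (from (L⇔ v) (h∈ , q))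

  HasCard-∷ : ∀ {a} {P : A → Set} {R : Vec A (suc n) → Set} →
    (∀ c C → R (c ∷ C) ⇔ (P c × Q c C)) →
    HasCard P a → (∀ c → P c → HasCard (Q c) b) → HasCard R (a * b)
  HasCard-∷ R⇔ (cs , cs-unique , cs⇔ , refl) Q-card =
    HasCard-cong (λ { (c ∷ C) → ⇔.trans (mk⇔ (λ (c∈ , q) → to (cs⇔ c) c∈ , q)
                                                (λ (pc , q) → from (cs⇔ c) pc , q))
                                          (⇔.sym (R⇔ c C)) })
                 (HasCard-∷-from cs cs-unique (λ c → Q-card c ∘ to (cs⇔ c)))

injective⇒surjective : ∀ {a b} (f : F2^ a → F2^ b) → Injective _≡_ _≡_ f → b ≤ a →
  ∀ z → ∃ λ x → f x ≡ z
injective⇒surjective {a} {b} f f-injective b≤a z = decide (hit? z)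
  where
  image = List.map f (allVecs a)
  hit? : ∀ x → Dec (x ∈ image)
  hit? x = Any.any? (x ≟ᵛ_) image
  hits≡2^a : length (filter hit? (allVecs b)) ≡ 2 ^ a
  hits≡2^a = HasCard-unique (HasCard-filter hit? (allVecs-unique b) ∈-allVecs)
    (image , Uniqueₚ.map⁺ f-injective (allVecs-unique a) , (λ _ → ⇔.refl) ,
     trans (Listₚ.length-map f (allVecs a)) (length-allVecs a))
  decide : Dec (z ∈ image) → ∃ λ x → f x ≡ z
  decide (yes z∈image) = let (x , _ , z≡fx) = ∈ₚ.∈-map⁻ f z∈image in x , sym z≡fx
  decide (no  z∉image) = contradiction (≤-trans hits<2^b (^-monoʳ-≤ 2 b≤a)) (<-irrefl hits≡2^a)
    where
    hits<2^b : length (filter hit? (allVecs b)) < 2 ^ b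
    hits<2^b = subst (length (filter hit? (allVecs b)) <_) (length-allVecs b)
      (Listₚ.filter-notAll hit? (allVecs b) (Any.map (λ { refl → z∉image }) (∈-allVecs z)))

⨁ : ∀ {A : Set} → List A → (A → Bool) → Bool
⨁ xs f = List.foldr (λ x acc → f x xor acc) false xs

⨁-++ : ∀ {A : Set} (xs ys : List A) f → ⨁ (xs ++ ys) f ≡ ⨁ xs f xor ⨁ ys f
⨁-++ []       ys f = refl
⨁-++ (x ∷ xs) ys f = trans (cong (f x xor_) (⨁-++ xs ys f)) (sym (xor-assoc (f x) _ _))

⨁-map : ∀ {A B : Set} (g : A → B) (xs : List A) f → ⨁ (List.map g xs) f ≡ ⨁ xs (f ∘ g)
⨁-map g []       f = refl
⨁-map g (x ∷ xs) f = cong (f (g x) xor_) (⨁-map g xs f)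

⨁-cong : ∀ {A : Set} (xs : List A) {f g : A → Bool} → (∀ x → f x ≡ g x) → ⨁ xs f ≡ ⨁ xs g
⨁-cong []       f≗g = refl
⨁-cong (x ∷ xs) f≗g = cong₂ _xor_ (f≗g x) (⨁-cong xs f≗g)

⨁-allVecs-suc : ∀ {n} (f : F2^ (suc n) → Bool) →
  ⨁ (allVecs (suc n)) f ≡ ⨁ (allVecs n) (f ∘ (false ∷_)) xor ⨁ (allVecs n) (f ∘ (true ∷_))
⨁-allVecs-suc {n} f =
  trans (⨁-++ (List.map (false ∷_) (allVecs n)) _ f)
        (cong₂ _xor_ (⨁-map (false ∷_) (allVecs n) f) (⨁-map (true ∷_) (allVecs n) f))

⨁-translate : ∀ {n} (f : F2^ n → Bool) (w : F2^ n) →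
  ⨁ (allVecs n) (λ x → f (x ⊕ w)) ≡ ⨁ (allVecs n) f
⨁-translate {zero}  f []          = refl
⨁-translate {suc n} f (false ∷ w) = begin
  ⨁ (allVecs (suc n)) (λ x → f (x ⊕ (false ∷ w)))
    ≡⟨ ⨁-allVecs-suc (λ x → f (x ⊕ (false ∷ w))) ⟩
  ⨁ (allVecs n) (λ x → f (false ∷ (x ⊕ w))) xor ⨁ (allVecs n) (λ x → f (true ∷ (x ⊕ w)))
    ≡⟨ cong₂ _xor_ (⨁-translate (f ∘ (false ∷_)) w) (⨁-translate (f ∘ (true ∷_)) w) ⟩
  ⨁ (allVecs n) (f ∘ (false ∷_)) xor ⨁ (allVecs n) (f ∘ (true ∷_))
    ≡⟨ sym (⨁-allVecs-suc f) ⟩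
  ⨁ (allVecs (suc n)) f ∎
  where open ≡-Reasoning
⨁-translate {suc n} f (true ∷ w)  = begin
  ⨁ (allVecs (suc n)) (λ x → f (x ⊕ (true ∷ w)))
    ≡⟨ ⨁-allVecs-suc (λ x → f (x ⊕ (true ∷ w))) ⟩
  ⨁ (allVecs n) (λ x → f (true ∷ (x ⊕ w))) xor ⨁ (allVecs n) (λ x → f (false ∷ (x ⊕ w)))
    ≡⟨ cong₂ _xor_ (⨁-translate (f ∘ (true ∷_)) w) (⨁-translate (f ∘ (false ∷_)) w) ⟩
  ⨁ (allVecs n) (f ∘ (true ∷_)) xor ⨁ (allVecs n) (f ∘ (false ∷_))
    ≡⟨ xor-comm (⨁ (allVecs n) (f ∘ (true ∷_))) (⨁ (allVecs n) (f ∘ (false ∷_))) ⟩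
  ⨁ (allVecs n) (f ∘ (false ∷_)) xor ⨁ (allVecs n) (f ∘ (true ∷_))
    ≡⟨ sym (⨁-allVecs-suc f) ⟩
  ⨁ (allVecs (suc n)) f ∎
  where open ≡-Reasoning

-- A nonzero period pairs up the points of 𝔽₂ⁿ, so every value is counted twice.
⨁-periodic : ∀ {n} (f : F2^ n → Bool) {v : F2^ n} → v ≢ 𝟎 →
  (∀ x → f (x ⊕ v) ≡ f x) → ⨁ (allVecs n) f ≡ false
⨁-periodic {zero}  f {[]} v≢𝟎 _ = contradiction refl v≢𝟎
⨁-periodic {suc n} f {true ∷ v} _ periodic = begin
  ⨁ (allVecs (suc n)) f
    ≡⟨ ⨁-allVecs-suc f ⟩
  ⨁ (allVecs n) (f ∘ (false ∷_)) xor ⨁ (allVecs n) (f ∘ (true ∷_))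
    ≡⟨ cong (_xor ⨁ (allVecs n) (f ∘ (true ∷_))) halves-agree ⟩
  ⨁ (allVecs n) (f ∘ (true ∷_)) xor ⨁ (allVecs n) (f ∘ (true ∷_))
    ≡⟨ xor-same (⨁ (allVecs n) (f ∘ (true ∷_))) ⟩
  false ∎
  where
  open ≡-Reasoning
  halves-agree : ⨁ (allVecs n) (f ∘ (false ∷_)) ≡ ⨁ (allVecs n) (f ∘ (true ∷_))
  halves-agree = trans (⨁-cong (allVecs n) (λ x → sym (periodic (false ∷ x))))
                       (⨁-translate (f ∘ (true ∷_)) v)
⨁-periodic {suc n} f {false ∷ v} v≢𝟎 periodic =
  trans (⨁-allVecs-suc f)
        (cong₂ _xor_ (⨁-periodic (f ∘ (false ∷_)) v′≢𝟎 (periodic ∘ (false ∷_)))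
                     (⨁-periodic (f ∘ (true ∷_)) v′≢𝟎 (periodic ∘ (true ∷_))))
  where
  v′≢𝟎 : v ≢ 𝟎
  v′≢𝟎 = v≢𝟎 ∘ cong (false ∷_)

⨁-point : ∀ {A : Set} {xs : List A} {p : A} {f : A → Bool} → Unique xs → p ∈ xs →
  (∀ x → f x ≡ true ⇔ x ≡ p) → ⨁ xs f ≡ true
⨁-point {f = f} (p∉xs ∷ _) (here refl) f⇔ =
  cong₂ _xor_ (from (f⇔ _) refl) (⨁-false (All.map (λ p≢x fx → p≢x (sym (to (f⇔ _) fx))) p∉xs))
  where
  ⨁-false : ∀ {xs} → All (λ x → f x ≢ true) xs → ⨁ xs f ≡ false
  ⨁-false []           = refl
  ⨁-false (fx≢true ∷ rest) = cong₂ _xor_ (¬-not fx≢true) (⨁-false rest)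
⨁-point (x∉xs ∷ xs-unique) (there p∈xs) f⇔ =
  cong₂ _xor_ (¬-not (All.lookup x∉xs p∈xs ∘ to (f⇔ _))) (⨁-point xs-unique p∈xs f⇔)

Independent : ∀ {n k} → Vec (F2^ n) k → Set
Independent B = TrivialKernel (lin B)

infix 4 _∈Span_
_∈Span_ : ∀ {n k} → F2^ n → Vec (F2^ n) k → Set
x ∈Span B = ∃ λ c → lin B c ≡ x

∈Span-⊕ : ∀ {n k} (B : Vec (F2^ n) k) {x y} → x ∈Span B → y ∈Span B → (x ⊕ y) ∈Span B
∈Span-⊕ B (c , refl) (c′ , refl) = c ⊕ c′ , lin-⊕ B c c′

_∈Span?_ : ∀ {n k} (x : F2^ n) (B : Vec (F2^ n) k) → Dec (x ∈Span B)
x ∈Span? B with Any.any? (λ c → lin B c ≟ᵛ x) (allVecs _)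
... | yes found = yes (Any.satisfied found)
... | no  none  = no λ (c , lin-c≡x) → none (Any.map (λ { refl → lin-c≡x }) (∈-allVecs c))

independent-∷⁻ : ∀ {n k} {b : F2^ n} {B : Vec (F2^ n) k} →
  Independent (b ∷ B) → ¬ b ∈Span B × Independent B
independent-∷⁻ {b = b} independent =
  (λ (c , lin-c≡b) → contradiction (independent (true ∷ c) (trans (cong (b ⊕_) lin-c≡b) (⊕-self b))) λ ()) ,
  (λ c lin-c≡𝟎 → Vecₚ.∷-injectiveʳ (independent (false ∷ c) lin-c≡𝟎))

independent-∷⁺ : ∀ {n k} {b : F2^ n} {B : Vec (F2^ n) k} →
  ¬ b ∈Span B → Independent B → Independent (b ∷ B)
independent-∷⁺ b∉span independent (true ∷ c)  b⊕lin-c≡𝟎 =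
  contradiction (c , sym (⊕≡𝟎⇒≡ b⊕lin-c≡𝟎)) b∉span
independent-∷⁺ b∉span independent (false ∷ c) lin-c≡𝟎   = cong (false ∷_) (independent c lin-c≡𝟎)

∈Span-fromList-toList⁻ : ∀ {n k} (B : Vec (F2^ n) k) {x} → x ∈Span fromList (toList B) → x ∈Span B
∈Span-fromList-toList⁻ []      ([] , lin≡x) = [] , lin≡x
∈Span-fromList-toList⁻ (b ∷ B) (c ∷ z , lin≡x) with ∈Span-fromList-toList⁻ B (z , refl)
... | z′ , lin-z′≡ = c ∷ z′ , trans (cong (λ u → if c then b ⊕ u else u) lin-z′≡) lin≡x

independent-fromList-toList : ∀ {n k} {B : Vec (F2^ n) k} → Independent B → Independent (fromList (toList B))
independent-fromList-toList {B = []}    _           = λ { [] _ → refl }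
independent-fromList-toList {B = b ∷ B} independent =
  let (b∉span , B-independent) = independent-∷⁻ {b = b} {B} independent
  in independent-∷⁺ (b∉span ∘ ∈Span-fromList-toList⁻ B) (independent-fromList-toList {B = B} B-independent)

HasCard-∈Span : ∀ {n k} (B : Vec (F2^ n) k) → Independent B → HasCard (_∈Span B) (2 ^ k)
HasCard-∈Span {k = k} B independent =
  HasCard-image (lin B) (λ _ _ → trivialKernel⇒injective (lin-⊕ B) independent)
    (λ x → mk⇔ (λ (c , lin-c≡x) → c , tt , lin-c≡x) (λ (c , _ , lin-c≡x) → c , lin-c≡x))
    (HasCard-F2^ k)

HasCard-∉Span : ∀ {n k} (B : Vec (F2^ n) k) → Independent B →
  HasCard (λ x → ¬ x ∈Span B) (2 ^ n ∸ 2 ^ k)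
HasCard-∉Span {n} B independent = HasCard-∁ (_∈Span? B) (HasCard-F2^ n) (HasCard-∈Span B independent)

π : ∀ {A : Set} {n} (J : Subset n) → Vec A n → Vec A ∣ J ∣
π []          []      = []
π (true ∷ J)  (a ∷ x) = a ∷ π J x
π (false ∷ J) (a ∷ x) = π J x

π-map : ∀ {A B : Set} {n} (f : A → B) (J : Subset n) (x : Vec A n) → π J (map f x) ≡ map f (π J x)
π-map f []          []      = refl
π-map f (true ∷ J)  (a ∷ x) = cong (f a ∷_) (π-map f J x)
π-map f (false ∷ J) (a ∷ x) = π-map f J x

π-⊕ : ∀ {n} (J : Subset n) (x y : F2^ n) → π J (x ⊕ y) ≡ π J x ⊕ π J y
π-⊕ []          []      []      = refl
π-⊕ (true ∷ J)  (a ∷ x) (b ∷ y) = cong ((a xor b) ∷_) (π-⊕ J x y)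
π-⊕ (false ∷ J) (a ∷ x) (b ∷ y) = π-⊕ J x y

π-𝟎 : ∀ {n} (J : Subset n) → π J (𝟎 {n}) ≡ 𝟎
π-𝟎 []          = refl
π-𝟎 (true ∷ J)  = cong (false ∷_) (π-𝟎 J)
π-𝟎 (false ∷ J) = π-𝟎 J

π-─-∩-↭ : ∀ {A : Set} {n} (M I : Subset n) (C : Vec A n) →
  toList (π M C) ↭ toList (π (M ─ I) C) ++ toList (π (M ∩ I) C)
π-─-∩-↭ []          []          []      = ↭-refl
π-─-∩-↭ (true ∷ M)  (true ∷ I)  (c ∷ C) =
  ↭-trans (↭-prep c (π-─-∩-↭ M I C)) (↭-sym (shift c (toList (π (M ─ I) C)) (toList (π (M ∩ I) C))))
π-─-∩-↭ (true ∷ M)  (false ∷ I) (c ∷ C) = ↭-prep c (π-─-∩-↭ M I C)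
π-─-∩-↭ (false ∷ M) (true ∷ I)  (c ∷ C) = π-─-∩-↭ M I C
π-─-∩-↭ (false ∷ M) (false ∷ I) (c ∷ C) = π-─-∩-↭ M I C

∣─∣+∣∩∣ : ∀ {n} (M I : Subset n) → ∣ M ─ I ∣ + ∣ M ∩ I ∣ ≡ ∣ M ∣
∣─∣+∣∩∣ M I = begin
  ∣ M ─ I ∣ + ∣ M ∩ I ∣
    ≡⟨ sym (cong₂ _+_ (Vecₚ.length-toList (π (M ─ I) M)) (Vecₚ.length-toList (π (M ∩ I) M))) ⟩
  length (toList (π (M ─ I) M)) + length (toList (π (M ∩ I) M))
    ≡⟨ sym (Listₚ.length-++ (toList (π (M ─ I) M))) ⟩
  length (toList (π (M ─ I) M) ++ toList (π (M ∩ I) M))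
    ≡⟨ sym (↭-length (π-─-∩-↭ M I M)) ⟩
  length (toList (π M M))
    ≡⟨ Vecₚ.length-toList (π M M) ⟩
  ∣ M ∣ ∎
  where open ≡-Reasoning

π-π-∩ : ∀ {A : Set} {n} (M I : Subset n) (C : Vec A n) →
  toList (π (π I (M ∩ I)) (π I C)) ≡ toList (π (M ∩ I) C)
π-π-∩ []          []          []      = refl
π-π-∩ (true ∷ M)  (true ∷ I)  (c ∷ C) = cong (c ∷_) (π-π-∩ M I C)
π-π-∩ (false ∷ M) (true ∷ I)  (c ∷ C) = π-π-∩ M I C
π-π-∩ (true ∷ M)  (false ∷ I) (c ∷ C) = π-π-∩ M I C
π-π-∩ (false ∷ M) (false ∷ I) (c ∷ C) = π-π-∩ M I C

∣π-∩∣ : ∀ {n} (M I : Subset n) → ∣ π I (M ∩ I) ∣ ≡ ∣ M ∩ I ∣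
∣π-∩∣ []          []          = refl
∣π-∩∣ (true ∷ M)  (true ∷ I)  = cong suc (∣π-∩∣ M I)
∣π-∩∣ (false ∷ M) (true ∷ I)  = ∣π-∩∣ M I
∣π-∩∣ (true ∷ M)  (false ∷ I) = ∣π-∩∣ M I
∣π-∩∣ (false ∷ M) (false ∷ I) = ∣π-∩∣ M I

lookup-─⁻ : ∀ {n} (M J : Subset n) p → lookup (M ─ J) p ≡ true →
  lookup M p ≡ true × lookup J p ≡ false
lookup-─⁻ (true ∷ M)  (false ∷ J) zero    _       = refl , refl
lookup-─⁻ (true ∷ M)  (true ∷ J)  zero    ()
lookup-─⁻ (false ∷ M) (true ∷ J)  zero    ()
lookup-─⁻ (false ∷ M) (false ∷ J) zero    ()
lookup-─⁻ (_ ∷ M)     (_ ∷ J)     (suc p) M─J∋p = lookup-─⁻ M J p M─J∋p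

lookup-∩ : ∀ {n} (M J : Subset n) p → lookup (M ∩ J) p ≡ lookup M p ∧ lookup J p
lookup-∩ M J p = Vecₚ.lookup-zipWith _∧_ p M J

∈Span-π⁻ : ∀ {n k} (S : Subset k) (B : Vec (F2^ n) k) {x} → x ∈Span π S B → x ∈Span B
∈Span-π⁻ []          []      x∈span            = x∈span
∈Span-π⁻ (true ∷ S)  (b ∷ B) (c ∷ z , lin≡x) with ∈Span-π⁻ S B (z , refl)
... | z′ , lin-z′≡ = c ∷ z′ , trans (cong (λ u → if c then b ⊕ u else u) lin-z′≡) lin≡x
∈Span-π⁻ (false ∷ S) (b ∷ B) x∈span with ∈Span-π⁻ S B x∈span
... | z′ , lin-z′≡ = false ∷ z′ , lin-z′≡

independent-π : ∀ {n k} (S : Subset k) {B : Vec (F2^ n) k} → Independent B → Independent (π S B)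
independent-π []          {[]} independent = independent
independent-π (true ∷ S)  {b ∷ B} independent =
  let (b∉span , B-independent) = independent-∷⁻ {b = b} {B} independent
  in independent-∷⁺ (b∉span ∘ ∈Span-π⁻ S B) (independent-π S {B} B-independent)
independent-π (false ∷ S) {b ∷ B} independent =
  independent-π S {B} (proj₂ (independent-∷⁻ {b = b} {B} independent))

-- Monomials and the parity of their sums over a subspace

𝟏 : ∀ {n} → F2^ n
𝟏 = replicate _ true

monomial≡true⇔ : ∀ {n} (J : Subset n) (x : F2^ n) → monomial J x ≡ true ⇔ π J x ≡ 𝟏
monomial≡true⇔ []          []          = mk⇔ (λ _ → refl) (λ _ → refl)
monomial≡true⇔ (true ∷ J)  (true ∷ x)  =
  mk⇔ (cong (true ∷_) ∘ to (monomial≡true⇔ J x)) (from (monomial≡true⇔ J x) ∘ Vecₚ.∷-injectiveʳ)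
monomial≡true⇔ (true ∷ J)  (false ∷ x) = mk⇔ (λ ()) (λ ())
monomial≡true⇔ (false ∷ J) (a ∷ x)     = monomial≡true⇔ J x

monomial-periodic : ∀ {n} (J : Subset n) (x : F2^ n) {v} → π J v ≡ 𝟎 → monomial J (x ⊕ v) ≡ monomial J x
monomial-periodic J x {v} πv≡𝟎 = ⇔→≡ (⇔.trans (monomial≡true⇔ J (x ⊕ v))
                                         (⇔.trans (mk⇔ (trans (sym πx⊕v≡πx)) (trans πx⊕v≡πx))
                                                  (⇔.sym (monomial≡true⇔ J x))))
  where
  πx⊕v≡πx : π J (x ⊕ v) ≡ π J x
  πx⊕v≡πx = trans (π-⊕ J x v) (trans (cong (π J x ⊕_) πv≡𝟎) (⊕-identityʳ (π J x)))

∧≡true⇔ : ∀ {a b} → a ∧ b ≡ true ⇔ (a ≡ true × b ≡ true)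
∧≡true⇔ {true} = mk⇔ (λ b≡true → refl , b≡true) proj₂
∧≡true⇔ {false} = mk⇔ (λ ()) (λ ())

-- If π J vanishes at some nonzero v ∈ U, the summand is v-periodic and the sum is 0; otherwise
-- π J is injective on U, hence (as ∣ J ∣ ≤ dim U) onto 𝔽₂^J, and x_J = 1 at exactly one point of U.
module _ {n k} {U : SubsetF2 n} (B : Vec (F2^ n) k)
         (B-independent : Independent B) (U⇔span : ∀ x → x ∈U U ≡ true ⇔ x ∈Span B)
         (J : Subset n) where

  sumOver-monomial⇒trivialKernel : sumOver U (monomial J) ≡ true → TrivialKernel (π J ∘ lin B)
  sumOver-monomial⇒trivialKernel sum≡true c πv≡𝟎 with c ≟ᵛ 𝟎
  ... | yes c≡𝟎 = c≡𝟎
  ... | no  c≢𝟎 = contradiction (trans (sym sum≡true) (⨁-periodic _ v≢𝟎 periodic)) λ ()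
    where
    v = lin B c
    v≢𝟎 : v ≢ 𝟎
    v≢𝟎 = c≢𝟎 ∘ B-independent c
    ∈U-periodic : ∀ x → (x ⊕ v) ∈U U ≡ x ∈U U
    ∈U-periodic x = ⇔→≡ (mk⇔
      (λ x⊕v∈U → from (U⇔span x)
        (subst (_∈Span B) (⊕-cancelʳ x v) (∈Span-⊕ B (to (U⇔span _) x⊕v∈U) (c , refl))))
      (λ x∈U → from (U⇔span _) (∈Span-⊕ B (to (U⇔span x) x∈U) (c , refl))))
    periodic : ∀ x → (x ⊕ v) ∈U U ∧ monomial J (x ⊕ v) ≡ x ∈U U ∧ monomial J x
    periodic x = cong₂ _∧_ (∈U-periodic x) (monomial-periodic J x πv≡𝟎)

  trivialKernel⇒sumOver-monomial : ∣ J ∣ ≤ k → TrivialKernel (π J ∘ lin B) → sumOver U (monomial J) ≡ true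
  trivialKernel⇒sumOver-monomial ∣J∣≤k kernel = ⨁-point (allVecs-unique n) (∈-allVecs x₁) at-x₁-only
    where
    h = π J ∘ lin B
    h-injective : Injective _≡_ _≡_ h
    h-injective = trivialKernel⇒injective (λ c c′ → trans (cong (π J) (lin-⊕ B c c′)) (π-⊕ J _ _)) kernel
    hits-𝟏 : ∃ λ c → h c ≡ 𝟏
    hits-𝟏 = injective⇒surjective h h-injective ∣J∣≤k 𝟏
    c₁ = proj₁ hits-𝟏
    h-c₁≡𝟏 : h c₁ ≡ 𝟏
    h-c₁≡𝟏 = proj₂ hits-𝟏
    x₁ = lin B c₁
    only-x₁ : ∀ x → x ∈U U ∧ monomial J x ≡ true → x ≡ x₁
    only-x₁ x x∈U∧x_J with to ∧≡true⇔ x∈U∧x_J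
    ... | x∈U , x_J≡true with to (U⇔span x) x∈U
    ... | c , refl = cong (lin B) (h-injective (trans (to (monomial≡true⇔ J (lin B c)) x_J≡true) (sym h-c₁≡𝟏)))
    at-x₁-only : ∀ x → x ∈U U ∧ monomial J x ≡ true ⇔ x ≡ x₁
    at-x₁-only x = mk⇔ (only-x₁ x)
      (λ { refl → from ∧≡true⇔ (from (U⇔span x₁) (c₁ , refl) ,
                                 from (monomial≡true⇔ J x₁) h-c₁≡𝟏) })

-- Dot product and matrices (a matrix is the vector of its rows)

infixl 7 _·_
_·_ : ∀ {n} → F2^ n → F2^ n → Bool
[]      · []      = false
(a ∷ x) · (b ∷ y) = (a ∧ b) xor (x · y)

·-comm : ∀ {n} (x y : F2^ n) → x · y ≡ y · x
·-comm []      []      = refl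
·-comm (a ∷ x) (b ∷ y) = cong₂ _xor_ (∧-comm a b) (·-comm x y)

·-𝟎ˡ : ∀ {n} (y : F2^ n) → 𝟎 · y ≡ false
·-𝟎ˡ []      = refl
·-𝟎ˡ (b ∷ y) = ·-𝟎ˡ y

·-⊕ˡ : ∀ {n} (x x′ y : F2^ n) → (x ⊕ x′) · y ≡ x · y xor x′ · y
·-⊕ˡ []      []        []      = refl
·-⊕ˡ (a ∷ x) (a′ ∷ x′) (b ∷ y) =
  trans (cong₂ _xor_ (∧-distribʳ-xor b a a′) (·-⊕ˡ x x′ y))
        (xor-interchange (a ∧ b) (a′ ∧ b) (x · y) (x′ · y))

·-⊕ʳ : ∀ {n} (x y y′ : F2^ n) → x · (y ⊕ y′) ≡ x · y xor x · y′
·-⊕ʳ x y y′ =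
  trans (·-comm x (y ⊕ y′)) (trans (·-⊕ˡ y y′ x) (cong₂ _xor_ (·-comm y x) (·-comm y′ x)))

infixl 6 _*ᵥ_
_*ᵥ_ : ∀ {n k} → Vec (F2^ k) n → F2^ k → F2^ n
M *ᵥ y = map (_· y) M

*ᵥ-additive : ∀ {n k} (M : Vec (F2^ k) n) → Additive (M *ᵥ_)
*ᵥ-additive []      y y′ = refl
*ᵥ-additive (m ∷ M) y y′ = cong₂ _∷_ (·-⊕ʳ m y y′) (*ᵥ-additive M y y′)

π-*ᵥ : ∀ {n k} (J : Subset n) (M : Vec (F2^ k) n) (y : F2^ k) → π J (M *ᵥ y) ≡ π J M *ᵥ y
π-*ᵥ J M y = π-map (_· y) J M

𝐈 : ∀ k → Vec (F2^ k) k
𝐈 zero    = []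
𝐈 (suc k) = (true ∷ 𝟎) ∷ map (false ∷_) (𝐈 k)

𝐈-*ᵥ : ∀ {k} (y : F2^ k) → 𝐈 k *ᵥ y ≡ y
𝐈-*ᵥ []              = refl
𝐈-*ᵥ {suc k} (b ∷ y) =
  cong₂ _∷_ (trans (cong (b xor_) (·-𝟎ˡ y)) (xor-identityʳ b))
            (trans (sym (Vecₚ.map-∘ (_· (b ∷ y)) (false ∷_) (𝐈 k))) (𝐈-*ᵥ y))

lin-𝐈 : ∀ {k} (y : F2^ k) → lin (𝐈 k) y ≡ y
lin-𝐈 []                 = refl
lin-𝐈 {suc k} (true ∷ y)  =
  trans (cong ((true ∷ 𝟎) ⊕_) (trans (lin-map (λ _ _ → refl) (𝐈 k) y) (cong (false ∷_) (lin-𝐈 y))))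
        (cong (true ∷_) (⊕-identityˡ y))
lin-𝐈 {suc k} (false ∷ y) = trans (lin-map (λ _ _ → refl) (𝐈 k) y) (cong (false ∷_) (lin-𝐈 y))

𝐈-independent : ∀ {k} → Independent (𝐈 k)
𝐈-independent c lin-c≡𝟎 = trans (sym (lin-𝐈 c)) lin-c≡𝟎

·-ext : ∀ {k} {x y : F2^ k} → (∀ u → u · x ≡ u · y) → x ≡ y
·-ext {k} {x} {y} x≈y = begin
  x            ≡⟨ sym (𝐈-*ᵥ x) ⟩
  𝐈 k *ᵥ x     ≡⟨ Vecₚ.map-cong x≈y (𝐈 k) ⟩
  𝐈 k *ᵥ y     ≡⟨ 𝐈-*ᵥ y ⟩
  y            ∎
  where open ≡-Reasoning

·-nondegenerate : ∀ {k} {y : F2^ k} → (∀ u → u · y ≡ false) → y ≡ 𝟎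
·-nondegenerate y⊥ = ·-ext (λ u → trans (y⊥ u) (sym (trans (·-comm u 𝟎) (·-𝟎ˡ u))))

*ᵥ-injective : ∀ {n k} {M M′ : Vec (F2^ k) n} → (∀ y → M *ᵥ y ≡ M′ *ᵥ y) → M ≡ M′
*ᵥ-injective {M = []}    {[]}      _    = refl
*ᵥ-injective {M = m ∷ M} {m′ ∷ M′} M≈M′ =
  cong₂ _∷_ (·-ext (λ u → trans (·-comm u m) (trans (cong head (M≈M′ u)) (·-comm m′ u))))
            (*ᵥ-injective (cong tail ∘ M≈M′))

lin-·-adjoint : ∀ {n k} (B : Vec (F2^ n) k) (c : F2^ k) (y : F2^ n) → lin B c · y ≡ c · (B *ᵥ y)
lin-·-adjoint []      []          y = ·-𝟎ˡ y
lin-·-adjoint (b ∷ B) (false ∷ c) y = lin-·-adjoint B c y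
lin-·-adjoint (b ∷ B) (true ∷ c)  y =
  trans (·-⊕ˡ b (lin B c) y) (cong (b · y xor_) (lin-·-adjoint B c y))

infix 10 _ᵀ
_ᵀ : ∀ {n k} → Vec (F2^ k) n → Vec (F2^ n) k
M ᵀ = map (M *ᵥ_) (𝐈 _)

lin-ᵀ : ∀ {n k} (M : Vec (F2^ k) n) (y : F2^ k) → lin (M ᵀ) y ≡ M *ᵥ y
lin-ᵀ M y = trans (lin-map (*ᵥ-additive M) (𝐈 _) y) (cong (M *ᵥ_) (lin-𝐈 y))

ᵀ-*ᵥ : ∀ {n k} (B : Vec (F2^ n) k) (c : F2^ k) → B ᵀ *ᵥ c ≡ lin B c
ᵀ-*ᵥ {n} B c = begin
  map (_· c) (map (B *ᵥ_) (𝐈 n))     ≡⟨ sym (Vecₚ.map-∘ (_· c) (B *ᵥ_) (𝐈 n)) ⟩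
  map (λ e → (B *ᵥ e) · c) (𝐈 n)     ≡⟨ Vecₚ.map-cong entry (𝐈 n) ⟩
  𝐈 n *ᵥ lin B c                     ≡⟨ 𝐈-*ᵥ (lin B c) ⟩
  lin B c                            ∎
  where
  open ≡-Reasoning
  entry : ∀ e → (B *ᵥ e) · c ≡ e · lin B c
  entry e = trans (·-comm (B *ᵥ e) c) (trans (sym (lin-·-adjoint B c e)) (·-comm (lin B c) e))

independent⇒trivialKernel : ∀ {k m} (B : Vec (F2^ k) m) → k ≤ m → Independent B → TrivialKernel (B *ᵥ_)
independent⇒trivialKernel B k≤m independent y By≡𝟎 = ·-nondegenerate λ u →
  let (z , lin-z≡u) = injective⇒surjective (lin B) (trivialKernel⇒injective (lin-⊕ B) independent) k≤m u
  in begin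
    u · y           ≡⟨ cong (_· y) (sym lin-z≡u) ⟩
    lin B z · y     ≡⟨ lin-·-adjoint B z y ⟩
    z · (B *ᵥ y)    ≡⟨ cong (z ·_) By≡𝟎 ⟩
    z · 𝟎           ≡⟨ trans (·-comm z 𝟎) (·-𝟎ˡ z) ⟩
    false           ∎
  where open ≡-Reasoning

trivialKernel⇒independent : ∀ {k m} (B : Vec (F2^ k) m) → m ≤ k → TrivialKernel (B *ᵥ_) → Independent B
trivialKernel⇒independent B m≤k kernel z lin-z≡𝟎 = ·-nondegenerate λ u →
  let (y , By≡u) = injective⇒surjective (B *ᵥ_) (trivialKernel⇒injective (*ᵥ-additive B) kernel) m≤k u
  in begin
    u · z           ≡⟨ cong (_· z) (sym By≡u) ⟩
    (B *ᵥ y) · z    ≡⟨ ·-comm (B *ᵥ y) z ⟩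
    z · (B *ᵥ y)    ≡⟨ sym (lin-·-adjoint B z y) ⟩
    lin B z · y     ≡⟨ cong (_· y) lin-z≡𝟎 ⟩
    𝟎 · y           ≡⟨ ·-𝟎ˡ y ⟩
    false           ∎
  where open ≡-Reasoning

TrivialAnnihilator : ∀ {k} → List (F2^ k) → Set
TrivialAnnihilator W = ∀ y → All (λ w → w · y ≡ false) W → y ≡ 𝟎

trivialAnnihilator-↭ : ∀ {k} {W W′ : List (F2^ k)} → W ↭ W′ → TrivialAnnihilator W → TrivialAnnihilator W′
trivialAnnihilator-↭ W↭W′ annihilator y W′⊥y = annihilator y (All-resp-↭ (↭-sym W↭W′) W′⊥y)

*ᵥ≡𝟎⇔ : ∀ {n k} (M : Vec (F2^ k) n) (y : F2^ k) →
  M *ᵥ y ≡ 𝟎 ⇔ All (λ w → w · y ≡ false) (toList M)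
*ᵥ≡𝟎⇔ []      y = mk⇔ (λ _ → []) (λ _ → refl)
*ᵥ≡𝟎⇔ (m ∷ M) y = mk⇔
  (λ My≡𝟎 → cong head My≡𝟎 ∷ to (*ᵥ≡𝟎⇔ M y) (cong tail My≡𝟎))
  (λ { (m⊥y ∷ M⊥y) → cong₂ _∷_ m⊥y (from (*ᵥ≡𝟎⇔ M y) M⊥y) })

trivialKernel⇔trivialAnnihilator : ∀ {n k} (M : Vec (F2^ k) n) →
  TrivialKernel (M *ᵥ_) ⇔ TrivialAnnihilator (toList M)
trivialKernel⇔trivialAnnihilator M = mk⇔
  (λ kernel y M⊥y → kernel y (from (*ᵥ≡𝟎⇔ M y) M⊥y))
  (λ annihilator y My≡𝟎 → annihilator y (to (*ᵥ≡𝟎⇔ M y) My≡𝟎))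

independent⇔trivialAnnihilator : ∀ {k} (W : List (F2^ k)) → length W ≡ k →
  Independent (fromList W) ⇔ TrivialAnnihilator W
independent⇔trivialAnnihilator W |W|≡k =
  subst (λ W′ → Independent (fromList W) ⇔ TrivialAnnihilator W′) (Vecₚ.toList∘fromList W)
    (⇔.trans (mk⇔ (independent⇒trivialKernel (fromList W) (≤-reflexive (sym |W|≡k)))
                  (trivialKernel⇒independent (fromList W) (≤-reflexive |W|≡k)))
             (trivialKernel⇔trivialAnnihilator (fromList W)))

-- Subspaces of 𝔽₂ⁿ and the matrices spanning them

toSubsetF2 : ∀ {n} → (F2^ n → Bool) → SubsetF2 n
toSubsetF2 {zero}  f = f []
toSubsetF2 {suc n} f = toSubsetF2 (f ∘ (false ∷_)) , toSubsetF2 (f ∘ (true ∷_))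

∈U-toSubsetF2 : ∀ {n} (f : F2^ n → Bool) (x : F2^ n) → x ∈U toSubsetF2 f ≡ f x
∈U-toSubsetF2 f []          = refl
∈U-toSubsetF2 f (false ∷ x) = ∈U-toSubsetF2 (f ∘ (false ∷_)) x
∈U-toSubsetF2 f (true ∷ x)  = ∈U-toSubsetF2 (f ∘ (true ∷_)) x

SubsetF2-ext : ∀ {n} {U V : SubsetF2 n} → (∀ x → x ∈U U ≡ x ∈U V) → U ≡ V
SubsetF2-ext {zero}                      U≈V = U≈V []
SubsetF2-ext {suc n} {l , r} {l′ , r′} U≈V =
  cong₂ _,_ (SubsetF2-ext (U≈V ∘ (false ∷_))) (SubsetF2-ext (U≈V ∘ (true ∷_)))

does≡true⇔ : ∀ {P : Set} (P? : Dec P) → does P? ≡ true ⇔ P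
does≡true⇔ (yes p) = mk⇔ (λ _ → p) (λ _ → refl)
does≡true⇔ (no ¬p) = mk⇔ (λ ()) (λ p → contradiction p ¬p)

⟨_⟩ : ∀ {n k} → Vec (F2^ n) k → SubsetF2 n
⟨ B ⟩ = toSubsetF2 (λ x → does (x ∈Span? B))

∈⟨⟩⇔ : ∀ {n k} (B : Vec (F2^ n) k) x → x ∈U ⟨ B ⟩ ≡ true ⇔ x ∈Span B
∈⟨⟩⇔ B x = subst (λ b → b ≡ true ⇔ x ∈Span B) (sym (∈U-toSubsetF2 _ x)) (does≡true⇔ (x ∈Span? B))

≡⟨⟩ : ∀ {n k} {U : SubsetF2 n} {B : Vec (F2^ n) k} →
  (∀ x → x ∈U U ≡ true ⇔ x ∈Span B) → U ≡ ⟨ B ⟩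
≡⟨⟩ {B = B} U⇔span = SubsetF2-ext (λ x → ⇔→≡ (⇔.trans (U⇔span x) (⇔.sym (∈⟨⟩⇔ B x))))

trivialKernel-cong : ∀ {m n} {f g : F2^ m → F2^ n} → (∀ x → f x ≡ g x) → TrivialKernel f → TrivialKernel g
trivialKernel-cong f≗g kernel x gx≡𝟎 = kernel x (trans (f≗g x) gx≡𝟎)

module _ {n} (I : Subset n) where

  Normal : Vec (F2^ ∣ I ∣) n → Set
  Normal C = π I C ≡ 𝐈 ∣ I ∣

  normal⇔ : ∀ {C} → Normal C ⇔ (∀ y → π I (C *ᵥ y) ≡ y)
  normal⇔ {C} = mk⇔
    (λ C-normal y → trans (π-*ᵥ I C y) (trans (cong (_*ᵥ y) C-normal) (𝐈-*ᵥ y)))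
    (λ π-C≈id → *ᵥ-injective (λ y → trans (sym (π-*ᵥ I C y)) (trans (π-C≈id y) (sym (𝐈-*ᵥ y)))))

  module _ {C : Vec (F2^ ∣ I ∣) n} (C-normal : Normal C) where

    columns-independent : Independent (C ᵀ)
    columns-independent y lin-y≡𝟎 = begin
      y                    ≡⟨ sym (to normal⇔ C-normal y) ⟩
      π I (C *ᵥ y)         ≡⟨ cong (π I) (sym (lin-ᵀ C y)) ⟩
      π I (lin (C ᵀ) y)    ≡⟨ cong (π I) lin-y≡𝟎 ⟩
      π I 𝟎                ≡⟨ π-𝟎 I ⟩
      𝟎                    ∎
      where open ≡-Reasoning

    InN-columns⇔ : (J : Subset n) → ∣ J ∣ ≡ ∣ I ∣ →
      InN ∣ I ∣ (monomial J) ⟨ C ᵀ ⟩ ⇔ TrivialKernel (π J C *ᵥ_)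
    InN-columns⇔ J ∣J∣≡∣I∣ = mk⇔
      (λ (_ , sum≡true) → trivialKernel-cong restrict
        (sumOver-monomial⇒trivialKernel (C ᵀ) columns-independent (∈⟨⟩⇔ (C ᵀ)) J sum≡true))
      (λ kernel → (C ᵀ , columns-independent , ∈⟨⟩⇔ (C ᵀ)) ,
        trivialKernel⇒sumOver-monomial (C ᵀ) columns-independent (∈⟨⟩⇔ (C ᵀ)) J
          (≤-reflexive ∣J∣≡∣I∣) (trivialKernel-cong (sym ∘ restrict) kernel))
      where
      restrict : ∀ y → π J (lin (C ᵀ) y) ≡ π J C *ᵥ y
      restrict y = trans (cong (π J) (lin-ᵀ C y)) (π-*ᵥ J C y)

    normal⇒InN : InN ∣ I ∣ (monomial I) ⟨ C ᵀ ⟩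
    normal⇒InN = from (InN-columns⇔ I refl) λ y y≡𝟎 →
      trans (sym (trans (cong (_*ᵥ y) C-normal) (𝐈-*ᵥ y))) y≡𝟎

  InN⇒normal : ∀ {U} → InN ∣ I ∣ (monomial I) U → ∃ λ C → Normal C × ⟨ C ᵀ ⟩ ≡ U
  InN⇒normal {U} ((B , B-independent , U⇔span) , sum≡true) = C , C-normal , sym (≡⟨⟩ U⇔columns)
    where
    h : F2^ ∣ I ∣ → F2^ ∣ I ∣
    h = π I ∘ lin B
    h-additive : Additive h
    h-additive c c′ = trans (cong (π I) (lin-⊕ B c c′)) (π-⊕ I _ _)
    h-injective : Injective _≡_ _≡_ h
    h-injective = trivialKernel⇒injective h-additive
      (sumOver-monomial⇒trivialKernel B B-independent U⇔span I sum≡true)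
    h-surjective : ∀ y → ∃ λ c → h c ≡ y
    h-surjective = injective⇒surjective h h-injective ≤-refl
    g : F2^ ∣ I ∣ → F2^ ∣ I ∣
    g = proj₁ ∘ h-surjective
    h∘g : ∀ y → h (g y) ≡ y
    h∘g = proj₂ ∘ h-surjective
    g∘h : ∀ c → g (h c) ≡ c
    g∘h c = h-injective (h∘g (h c))
    L : F2^ ∣ I ∣ → F2^ n
    L = lin B ∘ g
    L-additive : Additive L
    L-additive y y′ = trans (cong (lin B) (h-injective (begin
      h (g (y ⊕ y′))          ≡⟨ h∘g (y ⊕ y′) ⟩
      y ⊕ y′                  ≡⟨ sym (cong₂ _⊕_ (h∘g y) (h∘g y′)) ⟩
      h (g y) ⊕ h (g y′)      ≡⟨ sym (h-additive (g y) (g y′)) ⟩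
      h (g y ⊕ g y′)          ∎))) (lin-⊕ B (g y) (g y′))
      where open ≡-Reasoning
    C : Vec (F2^ ∣ I ∣) n
    C = map L (𝐈 ∣ I ∣) ᵀ
    C-*ᵥ : ∀ y → C *ᵥ y ≡ L y
    C-*ᵥ y = trans (ᵀ-*ᵥ (map L (𝐈 ∣ I ∣)) y)
                   (trans (lin-map L-additive (𝐈 ∣ I ∣) y) (cong L (lin-𝐈 y)))
    C-normal : Normal C
    C-normal = from normal⇔ (λ y → trans (cong (π I) (C-*ᵥ y)) (h∘g y))
    lin-Cᵀ : ∀ y → lin (C ᵀ) y ≡ L y
    lin-Cᵀ y = trans (lin-ᵀ C y) (C-*ᵥ y)
    U⇔columns : ∀ x → x ∈U U ≡ true ⇔ x ∈Span C ᵀ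
    U⇔columns x = ⇔.trans (U⇔span x) (mk⇔
      (λ (c , lin-c≡x) → h c , trans (lin-Cᵀ (h c)) (trans (cong (lin B) (g∘h c)) lin-c≡x))
      (λ (y , lin-y≡x) → g y , trans (sym (lin-Cᵀ y)) lin-y≡x))

  ⟨ᵀ⟩-injective : ∀ {C C′} → Normal C → Normal C′ → ⟨ C ᵀ ⟩ ≡ ⟨ C′ ᵀ ⟩ → C ≡ C′
  ⟨ᵀ⟩-injective {C} {C′} C-normal C′-normal ⟨Cᵀ⟩≡⟨C′ᵀ⟩ = *ᵥ-injective λ y →
    let Cy∈⟨C′ᵀ⟩ = subst (λ V → (C *ᵥ y) ∈U V ≡ true) ⟨Cᵀ⟩≡⟨C′ᵀ⟩
                         (from (∈⟨⟩⇔ (C ᵀ) _) (y , lin-ᵀ C y))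
        (y′ , lin-y′≡Cy) = to (∈⟨⟩⇔ (C′ ᵀ) _) Cy∈⟨C′ᵀ⟩
        C′y′≡Cy = trans (sym (lin-ᵀ C′ y′)) lin-y′≡Cy
        y′≡y = trans (sym (to normal⇔ C′-normal y′)) (trans (cong (π I) C′y′≡Cy) (to normal⇔ C-normal y))
    in trans (sym C′y′≡Cy) (cong (C′ *ᵥ_) y′≡y)

  HasCard-InN : ∀ {t N} (J : Fin t → Subset n) → (∀ i → ∣ J i ∣ ≡ ∣ I ∣) →
    HasCard (λ C → Normal C × ∀ i → TrivialKernel (π (J i) C *ᵥ_)) N →
    HasCard (λ U → InN ∣ I ∣ (monomial I) U × ∀ i → InN ∣ I ∣ (monomial (J i)) U) N
  HasCard-InN J ∣J∣≡∣I∣ =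
    HasCard-image (λ C → ⟨ C ᵀ ⟩)
      (λ (C-normal , _) (C′-normal , _) → ⟨ᵀ⟩-injective C-normal C′-normal)
      (λ U → mk⇔ (parametrise U) described)
    where
    Described : Vec (F2^ ∣ I ∣) n → Set
    Described C = Normal C × ∀ i → TrivialKernel (π (J i) C *ᵥ_)
    parametrise : ∀ U → InN ∣ I ∣ (monomial I) U × (∀ i → InN ∣ I ∣ (monomial (J i)) U) →
      ∃ λ C → Described C × ⟨ C ᵀ ⟩ ≡ U
    parametrise U (U∈N-I , U∈N-J) with InN⇒normal U∈N-I
    ... | C , C-normal , refl =
      C , (C-normal , λ i → to (InN-columns⇔ C-normal (J i) (∣J∣≡∣I∣ i)) (U∈N-J i)) , refl
    described : ∀ {U} → (∃ λ C → Described C × ⟨ C ᵀ ⟩ ≡ U) →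
      InN ∣ I ∣ (monomial I) U × (∀ i → InN ∣ I ∣ (monomial (J i)) U)
    described (C , (C-normal , kernels) , refl) =
      normal⇒InN C-normal , λ i → from (InN-columns⇔ C-normal (J i) (∣J∣≡∣I∣ i)) (kernels i)

∏ : ∀ {t} → (Fin t → ℕ) → ℕ
∏ {zero}  f = 1
∏ {suc t} f = f zero * ∏ (f ∘ suc)

∑ : ∀ {t} → (Fin t → ℕ) → ℕ
∑ {zero}  f = 0
∑ {suc t} f = f zero + ∑ (f ∘ suc)

∏-cong : ∀ {t} {f g : Fin t → ℕ} → (∀ i → f i ≡ g i) → ∏ f ≡ ∏ g
∏-cong {zero}  f≗g = refl
∏-cong {suc t} f≗g = cong₂ _*_ (f≗g zero) (∏-cong (f≗g ∘ suc))

∏-const : ∀ t c → ∏ {t} (λ _ → c) ≡ c ^ t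
∏-const zero    c = refl
∏-const (suc t) c = cong (c *_) (∏-const t c)

∏-extract : ∀ {t} (f g : Fin t → ℕ) (i : Fin t) x →
  f i ≡ x * g i → (∀ j → j ≢ i → f j ≡ g j) → ∏ f ≡ x * ∏ g
∏-extract f g zero    x fi≡x*gi f≈g = begin
  f zero * ∏ (f ∘ suc)        ≡⟨ cong₂ _*_ fi≡x*gi (∏-cong (λ j → f≈g (suc j) λ ())) ⟩
  x * g zero * ∏ (g ∘ suc)    ≡⟨ *-assoc x (g zero) _ ⟩
  x * (g zero * ∏ (g ∘ suc))  ∎
  where open ≡-Reasoning
∏-extract f g (suc i) x fi≡x*gi f≈g = begin
  f zero * ∏ (f ∘ suc)        ≡⟨ cong₂ _*_ (f≈g zero λ ()) (∏-extract (f ∘ suc) (g ∘ suc) i x fi≡x*gi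
                                   (λ j j≢i → f≈g (suc j) (j≢i ∘ Finₚ.suc-injective))) ⟩
  g zero * (x * ∏ (g ∘ suc))  ≡⟨ *-leftComm (g zero) x _ ⟩
  x * (g zero * ∏ (g ∘ suc))  ∎
  where open ≡-Reasoning

∑-cong : ∀ {t} {f g : Fin t → ℕ} → (∀ i → f i ≡ g i) → ∑ f ≡ ∑ g
∑-cong {zero}  f≗g = refl
∑-cong {suc t} f≗g = cong₂ _+_ (f≗g zero) (∑-cong (f≗g ∘ suc))

∑-const : ∀ t c → ∑ {t} (λ _ → c) ≡ t * c
∑-const zero    c = refl
∑-const (suc t) c = cong (c +_) (∑-const t c)

∑-+ʳ : ∀ {t} (f : Fin t → ℕ) c → ∑ (λ i → f i + c) ≡ ∑ f + t * c
∑-+ʳ {zero}  f c = refl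
∑-+ʳ {suc t} f c = trans (cong (f zero + c +_) (∑-+ʳ (f ∘ suc) c)) (+-interchange (f zero) c _ _)

∑-updateAt-suc : ∀ {t} (f : Fin t → ℕ) i → ∑ (updateAt f i suc) ≡ suc (∑ f)
∑-updateAt-suc f zero    = refl
∑-updateAt-suc f (suc i) = trans (cong (f zero +_) (∑-updateAt-suc (f ∘ suc) i)) (+-suc (f zero) _)

prod<-unfoldˡ : ∀ a (f : ℕ → ℕ) → prod< (suc a) f ≡ f 0 * prod< a (f ∘ suc)
prod<-unfoldˡ zero    f = trans (*-identityˡ (f 0)) (sym (*-identityʳ (f 0)))
prod<-unfoldˡ (suc a) f = trans (cong (_* f (suc a)) (prod<-unfoldˡ a f)) (*-assoc (f 0) _ _)

prod<-cong : ∀ a {f g : ℕ → ℕ} → (∀ i → f i ≡ g i) → prod< a f ≡ prod< a g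
prod<-cong zero    f≗g = refl
prod<-cong (suc a) f≗g = cong₂ _*_ (prod<-cong a f≗g) (f≗g a)

^-distribʳ-* : ∀ x y t → (x * y) ^ t ≡ x ^ t * y ^ t
^-distribʳ-* x y zero    = refl
^-distribʳ-* x y (suc t) = trans (cong ((x * y) *_) (^-distribʳ-* x y t)) (*-interchange x y (x ^ t) (y ^ t))

prod<-^ : ∀ a (f : ℕ → ℕ) t → prod< a f ^ t ≡ prod< a (λ i → f i ^ t)
prod<-^ zero    f t = ^-zeroˡ t
prod<-^ (suc a) f t = trans (^-distribʳ-* (prod< a f) (f a) t) (cong (_* f a ^ t) (prod<-^ a f t))

-- Counting matrices row by row

updateAt-elim : ∀ {A : Set} {t} (P : Fin t → A → Set) (v : Fin t → A) (i : Fin t) (f : A → A) →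
  P i (f (v i)) → (∀ j → j ≢ i → P j (v j)) → ∀ j → P j (updateAt v i f j)
updateAt-elim P v i f at-i elsewhere j with j Finₚ.≟ i
... | yes refl = subst (P i) (sym (updateAt-updates i v)) at-i
... | no  j≢i  = subst (P j) (sym (updateAt-minimal j i v j≢i)) (elsewhere j j≢i)

module RowCount (k t : ℕ) where

  Families : Set
  Families = Fin t → List (F2^ k)

  push : Families → Fin t → F2^ k → Families
  push Ws i c = updateAt Ws i (c ∷_)

  Labels : ℕ → Set
  Labels n = Vec (Maybe (Fin t)) n

  Admissible : ∀ {n} (I : Subset n) → Labels n → Vec (F2^ k) ∣ I ∣ → Families → Vec (F2^ k) n → Set
  Admissible []          []            []      Ws []      = ⊤
  Admissible (true ∷ I)  (_ ∷ G)       (e ∷ E) Ws (c ∷ C) = c ≡ e × Admissible I G E Ws C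
  Admissible (false ∷ I) (nothing ∷ G) E       Ws (c ∷ C) = Admissible I G E Ws C
  Admissible (false ∷ I) (just i ∷ G)  E       Ws (c ∷ C) =
    ¬ c ∈Span fromList (Ws i) × Admissible I G E (push Ws i c) C

  final : ∀ {n} (I : Subset n) → Labels n → Vec (F2^ k) n → Families → Families
  final []          []            []      Ws = Ws
  final (true ∷ I)  (_ ∷ G)       (_ ∷ C) Ws = final I G C Ws
  final (false ∷ I) (nothing ∷ G) (_ ∷ C) Ws = final I G C Ws
  final (false ∷ I) (just i ∷ G)  (c ∷ C) Ws = final I G C (push Ws i c)

  isLabel : Fin t → Maybe (Fin t) → Bool
  isLabel j (just i) = does (j Finₚ.≟ i)
  isLabel j nothing  = false

  labelledAs : ∀ {n} (I : Subset n) → Labels n → Fin t → Subset n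
  labelledAs I G j = tabulate (λ p → not (lookup I p) ∧ isLabel j (lookup G p))

  count : ∀ {n} (I : Subset n) → Labels n → (Fin t → ℕ) → ℕ
  count []          []            sizes = 1
  count (true ∷ I)  (_ ∷ G)       sizes = count I G sizes
  count (false ∷ I) (nothing ∷ G) sizes = 2 ^ k * count I G sizes
  count (false ∷ I) (just i ∷ G)  sizes = (2 ^ k ∸ 2 ^ sizes i) * count I G (updateAt sizes i suc)

  free : ∀ {n} (I : Subset n) → Labels n → ℕ
  free []          []            = 0
  free (true ∷ I)  (_ ∷ G)       = free I G
  free (false ∷ I) (nothing ∷ G) = suc (free I G)
  free (false ∷ I) (just _ ∷ G)  = free I G

  labelCount : ∀ {n} (I : Subset n) → Labels n → Fin t → ℕ
  labelCount []          []            = λ _ → 0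
  labelCount (true ∷ I)  (_ ∷ G)       = labelCount I G
  labelCount (false ∷ I) (nothing ∷ G) = labelCount I G
  labelCount (false ∷ I) (just i ∷ G)  = updateAt (labelCount I G) i suc

  IndependentFamilies : Families → Set
  IndependentFamilies Ws = ∀ j → Independent (fromList (Ws j))

  push-independent : ∀ {Ws i c} → IndependentFamilies Ws → ¬ c ∈Span fromList (Ws i) →
    IndependentFamilies (push Ws i c)
  push-independent {Ws} {i} independent c∉span =
    updateAt-elim (λ _ W → Independent (fromList W)) Ws i _
      (independent-∷⁺ c∉span (independent i)) (λ j _ → independent j)

  push-independent⁻ : ∀ {Ws i c} → IndependentFamilies (push Ws i c) →
    IndependentFamilies Ws × ¬ c ∈Span fromList (Ws i)
  push-independent⁻ {Ws} {i} {c} independent = independent′ , proj₁ at-i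
    where
    at-i : ¬ c ∈Span fromList (Ws i) × Independent (fromList (Ws i))
    at-i = independent-∷⁻ (subst (Independent ∘ fromList) (updateAt-updates i Ws) (independent i))
    independent′ : IndependentFamilies Ws
    independent′ j with j Finₚ.≟ i
    ... | yes refl = proj₂ at-i
    ... | no  j≢i  = subst (Independent ∘ fromList) (updateAt-minimal j i Ws j≢i) (independent j)

  push-length : ∀ {Ws sizes i c} → (∀ j → length (Ws j) ≡ sizes j) →
    ∀ j → length (push Ws i c j) ≡ updateAt sizes i suc j
  push-length {Ws} {sizes} {i} length≡ =
    updateAt-elim (λ j W → length W ≡ updateAt sizes i suc j) Ws i _
      (trans (cong suc (length≡ i)) (sym (updateAt-updates i sizes)))
      (λ j j≢i → trans (length≡ j) (sym (updateAt-minimal j i sizes j≢i)))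

  HasCard-admissible : ∀ {n} (I : Subset n) G E Ws sizes → IndependentFamilies Ws →
    (∀ j → length (Ws j) ≡ sizes j) → HasCard (Admissible I G E Ws) (count I G sizes)
  HasCard-admissible []          []            []      Ws sizes _           _       = HasCard-[] tt
  HasCard-admissible (true ∷ I)  (_ ∷ G)       (e ∷ E) Ws sizes independent length≡ =
    subst (HasCard _) (*-identityˡ _)
      (HasCard-∷ (λ _ _ → ⇔.refl) (HasCard-≡ e) λ _ _ → HasCard-admissible I G E Ws sizes independent length≡)
  HasCard-admissible (false ∷ I) (nothing ∷ G) E       Ws sizes independent length≡ =
    HasCard-∷ (λ _ _ → mk⇔ (tt ,_) proj₂) (HasCard-F2^ k)
      λ _ _ → HasCard-admissible I G E Ws sizes independent length≡
  HasCard-admissible (false ∷ I) (just i ∷ G)  E       Ws sizes independent length≡ =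
    HasCard-∷ (λ _ _ → ⇔.refl)
      (subst (λ s → HasCard _ (2 ^ k ∸ 2 ^ s)) (length≡ i) (HasCard-∉Span (fromList (Ws i)) (independent i)))
      λ c c∉span → HasCard-admissible I G E (push Ws i c) (updateAt sizes i suc)
                     (push-independent independent c∉span) (push-length length≡)

  final-independent⁻ : ∀ {n} (I : Subset n) G C Ws → IndependentFamilies (final I G C Ws) → IndependentFamilies Ws
  final-independent⁻ []          []            []      Ws independent = independent
  final-independent⁻ (true ∷ I)  (_ ∷ G)       (_ ∷ C) Ws independent = final-independent⁻ I G C Ws independent
  final-independent⁻ (false ∷ I) (nothing ∷ G) (_ ∷ C) Ws independent = final-independent⁻ I G C Ws independent
  final-independent⁻ (false ∷ I) (just i ∷ G)  (c ∷ C) Ws independent =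
    proj₁ (push-independent⁻ (final-independent⁻ I G C (push Ws i c) independent))

  admissible⇒ : ∀ {n} (I : Subset n) G E Ws C → IndependentFamilies Ws → Admissible I G E Ws C →
    π I C ≡ E × IndependentFamilies (final I G C Ws)
  admissible⇒ []          []            []      Ws []      independent _ = refl , independent
  admissible⇒ (true ∷ I)  (_ ∷ G)       (e ∷ E) Ws (c ∷ C) independent (c≡e , admissible) =
    let (πC≡E , final-independent) = admissible⇒ I G E Ws C independent admissible
    in cong₂ _∷_ c≡e πC≡E , final-independent
  admissible⇒ (false ∷ I) (nothing ∷ G) E       Ws (c ∷ C) independent admissible =
    admissible⇒ I G E Ws C independent admissible
  admissible⇒ (false ∷ I) (just i ∷ G)  E       Ws (c ∷ C) independent (c∉span , admissible) =
    admissible⇒ I G E (push Ws i c) C (push-independent independent c∉span) admissible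

  admissible⇐ : ∀ {n} (I : Subset n) G E Ws C → π I C ≡ E → IndependentFamilies (final I G C Ws) →
    Admissible I G E Ws C
  admissible⇐ []          []            []      Ws []      _    _           = tt
  admissible⇐ (true ∷ I)  (_ ∷ G)       (e ∷ E) Ws (c ∷ C) πC≡E independent =
    Vecₚ.∷-injectiveˡ πC≡E , admissible⇐ I G E Ws C (Vecₚ.∷-injectiveʳ πC≡E) independent
  admissible⇐ (false ∷ I) (nothing ∷ G) E       Ws (c ∷ C) πC≡E independent =
    admissible⇐ I G E Ws C πC≡E independent
  admissible⇐ (false ∷ I) (just i ∷ G)  E       Ws (c ∷ C) πC≡E independent =
    proj₂ (push-independent⁻ (final-independent⁻ I G C (push Ws i c) independent)) ,
    admissible⇐ I G E (push Ws i c) C πC≡E independent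

  HasCard-final : ∀ {n} (I : Subset n) G E Ws sizes →
    IndependentFamilies Ws → (∀ j → length (Ws j) ≡ sizes j) →
    HasCard (λ C → π I C ≡ E × IndependentFamilies (final I G C Ws)) (count I G sizes)
  HasCard-final I G E Ws sizes independent length≡ =
    HasCard-cong (λ C → mk⇔ (admissible⇒ I G E Ws C independent) λ (πC≡E , final-independent) →
                              admissible⇐ I G E Ws C πC≡E final-independent)
      (HasCard-admissible I G E Ws sizes independent length≡)

  final-↭ : ∀ {n} (I : Subset n) G C Ws j → final I G C Ws j ↭ toList (π (labelledAs I G j) C) ++ Ws j
  final-↭ []          []            []      Ws j = ↭-refl
  final-↭ (true ∷ I)  (_ ∷ G)       (_ ∷ C) Ws j = final-↭ I G C Ws j
  final-↭ (false ∷ I) (nothing ∷ G) (_ ∷ C) Ws j = final-↭ I G C Ws j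
  final-↭ (false ∷ I) (just i ∷ G)  (c ∷ C) Ws j with j Finₚ.≟ i
  ... | yes refl = ↭-trans (final-↭ I G C (push Ws i c) i)
                     (subst (λ W → π⟨i⟩ ++ W ↭ c ∷ π⟨i⟩ ++ Ws i) (sym (updateAt-updates i Ws))
                            (shift c π⟨i⟩ (Ws i)))
    where π⟨i⟩ = toList (π (labelledAs I G i) C)
  ... | no  j≢i  = subst (λ W → final I G C (push Ws i c) j ↭ toList (π (labelledAs I G j) C) ++ W)
                         (updateAt-minimal j i Ws j≢i) (final-↭ I G C (push Ws i c) j)

  ∣labelledAs∣ : ∀ {n} (I : Subset n) G j → ∣ labelledAs I G j ∣ ≡ labelCount I G j
  ∣labelledAs∣ []          []            j = refl
  ∣labelledAs∣ (true ∷ I)  (_ ∷ G)       j = ∣labelledAs∣ I G j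
  ∣labelledAs∣ (false ∷ I) (nothing ∷ G) j = ∣labelledAs∣ I G j
  ∣labelledAs∣ (false ∷ I) (just i ∷ G)  j with j Finₚ.≟ i
  ... | yes refl = trans (cong suc (∣labelledAs∣ I G i)) (sym (updateAt-updates i (labelCount I G)))
  ... | no  j≢i  = trans (∣labelledAs∣ I G j) (sym (updateAt-minimal j i (labelCount I G) j≢i))

  -- The number of ways to extend an independent family of s vectors of 𝔽₂ᵏ by a further vectors.
  extensions : ℕ → ℕ → ℕ
  extensions s a = prod< a (λ l → 2 ^ k ∸ 2 ^ (l + s))

  extensions-suc : ∀ s a → extensions s (suc a) ≡ (2 ^ k ∸ 2 ^ s) * extensions (suc s) a
  extensions-suc s a = trans (prod<-unfoldˡ a _)
    (cong ((2 ^ k ∸ 2 ^ s) *_) (prod<-cong a (λ l → cong (λ e → 2 ^ k ∸ 2 ^ e) (sym (+-suc l s)))))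

  count≡ : ∀ {n} (I : Subset n) G sizes →
    count I G sizes ≡ 2 ^ (k * free I G) * ∏ (λ j → extensions (sizes j) (labelCount I G j))
  count≡ []          []            sizes =
    sym (cong₂ _*_ (cong (2 ^_) (*-zeroʳ k)) (trans (∏-const t 1) (^-zeroˡ t)))
  count≡ (true ∷ I)  (_ ∷ G)       sizes = count≡ I G sizes
  count≡ (false ∷ I) (nothing ∷ G) sizes = begin
    2 ^ k * count I G sizes                    ≡⟨ cong (2 ^ k *_) (count≡ I G sizes) ⟩
    2 ^ k * (2 ^ (k * free I G) * P)           ≡⟨ sym (*-assoc (2 ^ k) _ P) ⟩
    2 ^ k * 2 ^ (k * free I G) * P             ≡⟨ cong (_* P) (sym (^-distribˡ-+-* 2 k _)) ⟩
    2 ^ (k + k * free I G) * P                 ≡⟨ cong (λ e → 2 ^ e * P) (sym (*-suc k (free I G))) ⟩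
    2 ^ (k * suc (free I G)) * P               ∎
    where
    open ≡-Reasoning
    P = ∏ (λ j → extensions (sizes j) (labelCount I G j))
  count≡ (false ∷ I) (just i ∷ G)  sizes = begin
    x * count I G (updateAt sizes i suc)       ≡⟨ cong (x *_) (count≡ I G (updateAt sizes i suc)) ⟩
    x * (2 ^ (k * free I G) * ∏ before)        ≡⟨ *-leftComm x (2 ^ (k * free I G)) (∏ before) ⟩
    2 ^ (k * free I G) * (x * ∏ before)
      ≡⟨ cong (2 ^ (k * free I G) *_) (sym (∏-extract after before i x at-i elsewhere)) ⟩
    2 ^ (k * free I G) * ∏ after               ∎
    where
    open ≡-Reasoning
    x = 2 ^ k ∸ 2 ^ sizes i
    before after : Fin t → ℕ
    before j = extensions (updateAt sizes i suc j) (labelCount I G j)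
    after  j = extensions (sizes j) (updateAt (labelCount I G) i suc j)
    at-i : after i ≡ x * before i
    at-i = begin
      extensions (sizes i) (updateAt (labelCount I G) i suc i)
        ≡⟨ cong (extensions (sizes i)) (updateAt-updates i (labelCount I G)) ⟩
      extensions (sizes i) (suc (labelCount I G i))
        ≡⟨ extensions-suc (sizes i) (labelCount I G i) ⟩
      x * extensions (suc (sizes i)) (labelCount I G i)
        ≡⟨ cong (λ s → x * extensions s (labelCount I G i)) (sym (updateAt-updates i sizes)) ⟩
      x * before i ∎
    elsewhere : ∀ j → j ≢ i → after j ≡ before j
    elsewhere j j≢i =
      cong₂ extensions (sym (updateAt-minimal j i sizes j≢i)) (updateAt-minimal j i (labelCount I G) j≢i)

  positions : ∀ {n} (I : Subset n) G → free I G + ∣ I ∣ + ∑ (labelCount I G) ≡ n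
  positions []          []            = trans (∑-const t 0) (*-zeroʳ t)
  positions (true ∷ I)  (_ ∷ G)       =
    trans (cong (_+ ∑ (labelCount I G)) (+-suc (free I G) ∣ I ∣)) (cong suc (positions I G))
  positions (false ∷ I) (nothing ∷ G) = cong suc (positions I G)
  positions (false ∷ I) (just i ∷ G)  =
    trans (cong (free I G + ∣ I ∣ +_) (∑-updateAt-suc (labelCount I G) i))
          (trans (+-suc _ _) (cong suc (positions I G)))

  count-uniform : ∀ {n} (I : Subset n) G d → ∣ I ∣ ≡ k → (∀ j → labelCount I G j + d ≡ k) →
    count I G (λ _ → d) ≡ 2 ^ (k * (n + t * d ∸ suc t * k)) * prod< (k ∸ d) (λ l → (2 ^ k ∸ 2 ^ (l + d)) ^ t)
  count-uniform {n} I G d ∣I∣≡k labelCount+d≡k = begin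
    count I G (λ _ → d)
      ≡⟨ count≡ I G (λ _ → d) ⟩
    2 ^ (k * free I G) * ∏ (λ j → extensions d (labelCount I G j))
      ≡⟨ cong₂ (λ f P → 2 ^ (k * f) * P) free≡ (∏-cong (cong (extensions d) ∘ labelCount≡)) ⟩
    2 ^ (k * (n + t * d ∸ suc t * k)) * ∏ {t} (λ _ → extensions d (k ∸ d))
      ≡⟨ cong (2 ^ (k * (n + t * d ∸ suc t * k)) *_) (trans (∏-const t _) (prod<-^ (k ∸ d) _ t)) ⟩
    2 ^ (k * (n + t * d ∸ suc t * k)) * prod< (k ∸ d) (λ l → (2 ^ k ∸ 2 ^ (l + d)) ^ t) ∎
    where
    open ≡-Reasoning
    labelCount≡ : ∀ j → labelCount I G j ≡ k ∸ d
    labelCount≡ j = trans (sym (m+n∸n≡m _ d)) (cong (_∸ d) (labelCount+d≡k j))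
    ∑labelCount+td≡tk : ∑ (labelCount I G) + t * d ≡ t * k
    ∑labelCount+td≡tk = trans (sym (∑-+ʳ (labelCount I G) d)) (trans (∑-cong labelCount+d≡k) (∑-const t k))
    free≡ : free I G ≡ n + t * d ∸ suc t * k
    free≡ = sym (begin
      n + t * d ∸ (k + t * k)
        ≡⟨ cong (λ m → m + t * d ∸ (k + t * k)) (sym (positions I G)) ⟩
      free I G + ∣ I ∣ + ∑ (labelCount I G) + t * d ∸ (k + t * k)
        ≡⟨ cong (_∸ (k + t * k)) (+-assoc (free I G + ∣ I ∣) _ _) ⟩
      free I G + ∣ I ∣ + (∑ (labelCount I G) + t * d) ∸ (k + t * k)
        ≡⟨ cong₂ (λ a b → free I G + a + b ∸ (k + t * k)) ∣I∣≡k ∑labelCount+td≡tk ⟩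
      free I G + k + t * k ∸ (k + t * k)
        ≡⟨ cong (_∸ (k + t * k)) (+-assoc (free I G) k (t * k)) ⟩
      free I G + (k + t * k) ∸ (k + t * k)
        ≡⟨ m+n∸n≡m (free I G) (k + t * k) ⟩
      free I G ∎)

module Sunflower {n t} (m : Fin (suc t) → Subset n) (D : Subset n)
                 (meet : ∀ i j → i ≢ j → m i ∩ m j ≡ D) where

  I : Subset n
  I = m zero

  petal core : Fin t → Subset n
  petal i = m (suc i) ─ I
  core  i = m (suc i) ∩ I

  open RowCount ∣ I ∣ t

  petalOf : ∀ {p} → Dec (∃ λ i → lookup (petal i) p ≡ true) → Maybe (Fin t)
  petalOf (yes (i , _)) = just i
  petalOf (no _)        = nothing

  labels : Labels n
  labels = tabulate λ p → petalOf (Finₚ.any? λ i → lookup (petal i) p ≟ᴮ true)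

  petals-disjoint : ∀ {i j p} → i ≢ j → lookup I p ≡ false →
    lookup (m (suc i)) p ≡ true → lookup (petal j) p ≢ true
  petals-disjoint {i} {j} {p} i≢j I∌p Mi∋p petal-j∋p = contradiction (trans (sym I∌p) I∋p) λ ()
    where
    Mi∩Mj∋p : lookup D p ≡ true
    Mi∩Mj∋p = begin
      lookup D p
        ≡⟨ cong (λ S → lookup S p) (sym (meet (suc i) (suc j) (i≢j ∘ Finₚ.suc-injective))) ⟩
      lookup (m (suc i) ∩ m (suc j)) p
        ≡⟨ lookup-∩ (m (suc i)) (m (suc j)) p ⟩
      lookup (m (suc i)) p ∧ lookup (m (suc j)) p
        ≡⟨ cong₂ _∧_ Mi∋p (proj₁ (lookup-─⁻ (m (suc j)) I p petal-j∋p)) ⟩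
      true ∎
      where open ≡-Reasoning
    I∋p : lookup I p ≡ true
    I∋p = proj₂ (to ∧≡true⇔ (trans (sym (lookup-∩ (m (suc j)) I p))
                 (trans (cong (λ S → lookup S p) (meet (suc j) zero λ ())) Mi∩Mj∋p)))

  isLabel-petalOf : ∀ i {p} (found : Dec (∃ λ j → lookup (petal j) p ≡ true)) → lookup I p ≡ false →
    isLabel i (petalOf found) ≡ lookup (petal i) p
  isLabel-petalOf i (no none)          _   = sym (¬-not λ petal-i∋p → none (i , petal-i∋p))
  isLabel-petalOf i (yes (j , petal-j∋p)) I∌p with i Finₚ.≟ j
  ... | yes refl = sym petal-j∋p
  ... | no  i≢j  = sym (¬-not λ petal-i∋p →
          petals-disjoint i≢j I∌p (proj₁ (lookup-─⁻ (m (suc i)) I _ petal-i∋p)) petal-j∋p)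

  labelledAs-labels : ∀ i → labelledAs I labels i ≡ petal i
  labelledAs-labels i = trans (Vecₚ.tabulate-cong labelled≗petal) (Vecₚ.tabulate∘lookup (petal i))
    where
    labelled≗petal : ∀ p → not (lookup I p) ∧ isLabel i (lookup labels p) ≡ lookup (petal i) p
    labelled≗petal p
      rewrite Vecₚ.lookup∘tabulate (λ p → petalOf (Finₚ.any? λ i → lookup (petal i) p ≟ᴮ true)) p
      with lookup I p in I[p]
    ... | true  = sym (¬-not λ petal-i∋p →
                    contradiction (trans (sym I[p]) (proj₂ (lookup-─⁻ (m (suc i)) I p petal-i∋p))) λ ())
    ... | false = isLabel-petalOf i (Finₚ.any? λ i → lookup (petal i) p ≟ᴮ true) I[p]

  coreRows : Families
  coreRows i = toList (π (π I (core i)) (𝐈 ∣ I ∣))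

  coreRows-independent : IndependentFamilies coreRows
  coreRows-independent i = independent-fromList-toList {B = π (π I (core i)) (𝐈 ∣ I ∣)}
    (independent-π (π I (core i)) {𝐈 ∣ I ∣} 𝐈-independent)

  module _ {d} (∣m∣≡∣I∣ : ∀ i → ∣ m i ∣ ≡ ∣ I ∣) (∣D∣≡d : ∣ D ∣ ≡ d) where

    ∣core∣≡d : ∀ i → ∣ core i ∣ ≡ d
    ∣core∣≡d i = trans (cong ∣_∣ (meet (suc i) zero λ ())) ∣D∣≡d

    length-coreRows : ∀ i → length (coreRows i) ≡ d
    length-coreRows i = trans (Vecₚ.length-toList (π (π I (core i)) (𝐈 ∣ I ∣)))
                         (trans (∣π-∩∣ (m (suc i)) I) (∣core∣≡d i))

    labelCount+d≡∣I∣ : ∀ i → labelCount I labels i + d ≡ ∣ I ∣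
    labelCount+d≡∣I∣ i = begin
      labelCount I labels i + d        ≡⟨ cong₂ _+_ (sym (∣labelledAs∣ I labels i)) (sym (∣core∣≡d i)) ⟩
      ∣ labelledAs I labels i ∣ + ∣ core i ∣
                                       ≡⟨ cong (λ S → ∣ S ∣ + ∣ core i ∣) (labelledAs-labels i) ⟩
      ∣ petal i ∣ + ∣ core i ∣         ≡⟨ ∣─∣+∣∩∣ (m (suc i)) I ⟩
      ∣ m (suc i) ∣                    ≡⟨ ∣m∣≡∣I∣ (suc i) ⟩
      ∣ I ∣                            ∎
      where open ≡-Reasoning

    final-↭-π : ∀ {C} → Normal I C → ∀ i → final I labels C coreRows i ↭ toList (π (m (suc i)) C)
    final-↭-π {C} C-normal i = ↭-trans (final-↭ I labels C coreRows i)
      (subst₂ (λ P Q → P ++ Q ↭ toList (π (m (suc i)) C))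
        (cong (λ S → toList (π S C)) (sym (labelledAs-labels i)))
        (trans (sym (π-π-∩ (m (suc i)) I C)) (cong (λ E → toList (π (π I (core i)) E)) C-normal))
        (↭-sym (π-─-∩-↭ (m (suc i)) I C)))

    final-independent⇔ : ∀ {C} → Normal I C → ∀ i →
      Independent (fromList (final I labels C coreRows i)) ⇔ TrivialKernel (π (m (suc i)) C *ᵥ_)
    final-independent⇔ {C} C-normal i =
      ⇔.trans (independent⇔trivialAnnihilator (final I labels C coreRows i) length-final)
      (⇔.trans (mk⇔ (trivialAnnihilator-↭ (final-↭-π C-normal i))
                    (trivialAnnihilator-↭ (↭-sym (final-↭-π C-normal i))))
               (⇔.sym (trivialKernel⇔trivialAnnihilator (π (m (suc i)) C))))
      where
      length-final : length (final I labels C coreRows i) ≡ ∣ I ∣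
      length-final = trans (↭-length (final-↭-π C-normal i))
                           (trans (Vecₚ.length-toList (π (m (suc i)) C)) (∣m∣≡∣I∣ (suc i)))

    HasCard-normal : HasCard (λ C → Normal I C × ∀ i → TrivialKernel (π (m (suc i)) C *ᵥ_))
      (2 ^ (∣ I ∣ * (n + t * d ∸ suc t * ∣ I ∣))
        * prod< (∣ I ∣ ∸ d) (λ l → (2 ^ ∣ I ∣ ∸ 2 ^ (l + d)) ^ t))
    HasCard-normal = subst (HasCard _) (count-uniform I labels d refl labelCount+d≡∣I∣)
      (HasCard-cong (λ C → mk⇔
          (λ (C-normal , independent) → C-normal , λ i → to (final-independent⇔ C-normal i) (independent i))
          (λ (C-normal , kernels) → C-normal , λ i → from (final-independent⇔ C-normal i) (kernels i)))
        (HasCard-final I labels (𝐈 ∣ I ∣) coreRows (λ _ → d) coreRows-independent length-coreRows))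

lemma5p4 : (n k d t : ℕ) (m : Fin (suc t) → Subset n) →
    (∀ i j → i ≢ j → m i ≢ m j) →
    Homogeneous k m →
    Intersecting d m →
    HasSize (λ U → ∀ i → InN k (monomial (m i)) U)
      (2 ^ (k * (n + t * d ∸ suc t * k))
        * prod< (k ∸ d) (λ i → (2 ^ k ∸ 2 ^ (i + d)) ^ t))
lemma5p4 n k d t m _ homogeneous (_ , D , ∣D∣≡d , meet) with refl ← homogeneous zero =
  HasCard-cong (λ U → Finₚ.∀-cons-⇔)
    (HasCard-InN (m zero) (m ∘ suc) (homogeneous ∘ suc)
      (Sunflower.HasCard-normal m D meet homogeneous ∣D∣≡d))
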